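{- Let $M$ be a regular matroid, $\sigma$ a triangulating circuit signature and $\sigma^*$ a triangulating cocircuit signature of $M$, and $e$ an element of the ground set. If $e$ is not a coloop then $\sigma\setminus e$ is a triangulating circuit signature and $\sigma^*\setminus e$ a triangulating cocircuit signature of $M\setminus e$; if $e$ is not a loop then $\sigma/e$ is a triangulating circuit signature and $\sigma^*/e$ a triangulating cocircuit signature of $M/e$.
   Context: $M=M(A)$ is represented by a real totally unimodular matrix $A$ of full row rank with columns indexed by $E$; bases are index sets of nonsingular maximal square submatrices; circuits minimal sets in no basis, cocircuits minimal sets meeting every basis; loops lie in no basis, coloops in every basis. A signed circuit (cocircuit) is an element of $\ker A$ (row space of $A$) with coefficients in $\{ -1,0,1\}$ whose support is a circuit (cocircuit). A circuit signature picks one signed circuit $\sigma(C)$ on each circuit $C$; cocircuit signatures likewise. Fourientations are maps to subsets of $\{+,-\}$; $-\vec F$ swaps $+,-$, $\cap$ is pointwise, and a 1-chain $\vec P$ is compatible with $\vec F$ if the sign of $\vec P(x)$ lies in $\vec F(x)$ for all $x$ in its support. $\vec F(B,\sigma)$ is $\{+,-\}$ on the basis $B$ and at $x\notin B$ the sign of $\sigma(C_x)(x)$ ($C_x\subseteq B\cup\{x\}$ the fundamental circuit); $\vec F(B,\sigma^*)$ is $\{+,-\}$ off $B$ and at $x\in B$ the sign of $\sigma^*(C^*_x)(x)$ ($C^*_x$ the fundamental cocircuit). $\sigma$ is triangulating if for distinct bases $B_1,B_2$ no signed circuit is compatible with $\vec F(B_1,\sigma)\cap-\vec F(B_2,\sigma)$;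 $\sigma^*$ is triangulating if no signed cocircuit is compatible with $\vec F(B_1,\sigma^*)\cap-\vec F(B_2,\sigma^*)$. Minors: $M\setminus e$ has bases $\{B:e\notin B\}$, $M/e$ has bases $\{B\setminus e: e\in B\}$; signed circuits of $M\setminus e$ are $\vec C\setminus e$ for signed circuits with $\vec C(e)=0$, those of $M/e$ are the support-minimal nonzero elements of $\{\vec C\setminus e\}$; signed cocircuits of $M/e$ are $\vec C^*\setminus e$ with $\vec C^*(e)=0$, those of $M\setminus e$ are the support-minimal nonzero elements of $\{\vec C^*\setminus e\}$ (here $\vec P\setminus e$ is restriction to $E\setminus\{e\}$). $\sigma\setminus e=\{\vec C\setminus e:\vec C\in\sigma\}\cap\{\text{signed circuits of }M\setminus e\}$, $\sigma/e$ analogously, and similarly for $\sigma^*$. -}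

module Defs where

open import Data.Nat using (ℕ; zero; suc)
open import Data.Fin using (Fin; zero; suc; punchIn)
open import Data.Integer using (ℤ; +_; -_; _+_; _*_)
open import Data.Rational as ℚ using (ℚ)
open import Data.Bool using (Bool; true; false)
open import Data.Vec using (Vec; lookup; tabulate; insertAt; removeAt; replicate)
open import Data.Fin.Subset using (Subset; _∈_; _∉_; _⊆_; _∪_; ⁅_⁆; ∁)
open import Data.Product using (Σ; ∃; _×_; _,_)
open import Data.Sum using (_⊎_)
open import Relation.Binary.PropositionalEquality using (_≡_; _≢_)
open import Relation.Nullary using (¬_)
open import Function.Definitions using (Injective)
open import Level using () renaming (suc to lsuc; zero to lzero)

Matrix : Set → ℕ → ℕ → Set
Matrix A m n = Fin m → Fin n → A

∑ : ∀ {n} → (Fin n → ℤ) → ℤ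
∑ {zero}  f = + 0
∑ {suc n} f = f zero + ∑ (λ i → f (suc i))

∑ℚ : ∀ {n} → (Fin n → ℚ) → ℚ
∑ℚ {zero}  f = ℚ.0ℚ
∑ℚ {suc n} f = f zero ℚ.+ ∑ℚ (λ i → f (suc i))

altSign : ℕ → ℤ
altSign zero          = + 1
altSign (suc zero)    = - (+ 1)
altSign (suc (suc k)) = altSign k

det : ∀ {n} → Matrix ℤ n n → ℤ
det {zero}  M = + 1
det {suc n} M =
  ∑ (λ j → altSign (Data.Fin.toℕ j) * (M zero j * det (λ i k → M (suc i) (punchIn j k))))

subMatrix : ∀ {m n k} → Matrix ℤ m n → (Fin k → Fin m) → (Fin k → Fin n) → Matrix ℤ k k
subMatrix A f g i j = A (f i) (g j)

UnitOrZero : ℤ → Set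
UnitOrZero z = (z ≡ - (+ 1)) ⊎ (z ≡ + 0) ⊎ (z ≡ + 1)

TotallyUnimodular : ∀ {m n} → Matrix ℤ m n → Set
TotallyUnimodular {m} {n} A =
  ∀ k (f : Fin k → Fin m) (g : Fin k → Fin n) →
  Injective _≡_ _≡_ f → Injective _≡_ _≡_ g → UnitOrZero (det (subMatrix A f g))

FullRowRank : ∀ {m n} → Matrix ℤ m n → Set
FullRowRank {m} {n} A =
  Σ (Fin m → Fin n) λ g → Injective _≡_ _≡_ g × det (subMatrix A (λ i → i) g) ≢ + 0

data Sgn : Set where
  ⊖ 𝟘 ⊕ : Sgn

flipSgn : Sgn → Sgn
flipSgn ⊖ = ⊕
flipSgn 𝟘 = 𝟘
flipSgn ⊕ = ⊖

sgnℤ : Sgn → ℤ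
sgnℤ ⊖ = - (+ 1)
sgnℤ 𝟘 = + 0
sgnℤ ⊕ = + 1

isNonzero : Sgn → Bool
isNonzero 𝟘 = false
isNonzero _ = true

Chain : ℕ → Set
Chain n = Vec Sgn n

supp : ∀ {n} → Chain n → Subset n
supp P = tabulate (λ i → isNonzero (lookup P i))

zeroChain : ∀ {n} → Chain n
zeroChain = replicate _ 𝟘

-- A fourientation: F x s means the sign s (⊕ or ⊖) belongs to F(x).
Fourientation : ℕ → Set₁
Fourientation n = Fin n → Sgn → Set

neg : ∀ {n} → Fourientation n → Fourientation n
neg F x s = F x (flipSgn s)

_∩F_ : ∀ {n} → Fourientation n → Fourientation n → Fourientation n
(F ∩F G) x s = F x s × G x s

Compatible : ∀ {n} → Chain n → Fourientation n → Set
Compatible P F = ∀ x → lookup P x ≢ 𝟘 → F x (lookup P x)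

record SignedMatroid (n : ℕ) : Set₁ where
  field
    IsBasis   : Subset n → Set
    SCirc     : Chain n → Set
    SCocirc   : Chain n → Set

module _ {n : ℕ} (M : SignedMatroid n) where
  open SignedMatroid M

  IsCircuit : Subset n → Set
  IsCircuit C =
    (¬ Σ (Subset n) λ B → IsBasis B × C ⊆ B) ×
    (∀ D → D ⊆ C → D ≢ C → Σ (Subset n) λ B → IsBasis B × D ⊆ B)

  IsCocircuit : Subset n → Set
  IsCocircuit C =
    (∀ B → IsBasis B → ∃ λ x → x ∈ C × x ∈ B) ×
    (∀ D → D ⊆ C → D ≢ C → Σ (Subset n) λ B → IsBasis B × (∀ x → x ∈ D → x ∉ B))

  IsLoop : Fin n → Set
  IsLoop e = ∀ B → IsBasis B → e ∉ B

  IsColoop : Fin n → Set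
  IsColoop e = ∀ B → IsBasis B → e ∈ B

  IsCircuitSignature : (Chain n → Set) → Set
  IsCircuitSignature σ =
    (∀ P → σ P → SCirc P) ×
    (∀ C → IsCircuit C →
       Σ (Chain n) λ P → σ P × supp P ≡ C × (∀ Q → σ Q → supp Q ≡ C → Q ≡ P))

  IsCocircuitSignature : (Chain n → Set) → Set
  IsCocircuitSignature σ* =
    (∀ P → σ* P → SCocirc P) ×
    (∀ C → IsCocircuit C →
       Σ (Chain n) λ P → σ* P × supp P ≡ C × (∀ Q → σ* Q → supp Q ≡ C → Q ≡ P))

  -- F(B,σ): {+,-} on B; at x ∉ B the sign of σ(C_x)(x), C_x ⊆ B ∪ {x}
  -- the fundamental circuit
  FB : Subset n → (Chain n → Set) → Fourientation n
  FB B σ x s =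
    x ∈ B ⊎
    (x ∉ B × Σ (Subset n) λ C → IsCircuit C × C ⊆ (B ∪ ⁅ x ⁆) ×
       Σ (Chain n) λ P → σ P × supp P ≡ C × lookup P x ≡ s)

  -- F(B,σ*): {+,-} off B; at x ∈ B the sign of σ*(C*_x)(x), C*_x ⊆ (E∖B) ∪ {x}
  -- the fundamental cocircuit
  FB* : Subset n → (Chain n → Set) → Fourientation n
  FB* B σ* x s =
    x ∉ B ⊎
    (x ∈ B × Σ (Subset n) λ C → IsCocircuit C × C ⊆ (∁ B ∪ ⁅ x ⁆) ×
       Σ (Chain n) λ P → σ* P × supp P ≡ C × lookup P x ≡ s)

  IsTriangulating : (Chain n → Set) → Set
  IsTriangulating σ =
    ∀ B₁ B₂ → IsBasis B₁ → IsBasis B₂ → B₁ ≢ B₂ →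
    ∀ P → SCirc P → ¬ Compatible P (FB B₁ σ ∩F neg (FB B₂ σ))

  IsTriangulating* : (Chain n → Set) → Set
  IsTriangulating* σ* =
    ∀ B₁ B₂ → IsBasis B₁ → IsBasis B₂ → B₁ ≢ B₂ →
    ∀ P → SCocirc P → ¬ Compatible P (FB* B₁ σ* ∩F neg (FB* B₂ σ*))

ℤtoℚ : ℤ → ℚ
ℤtoℚ z = z ℚ./ 1

InKernel : ∀ {m n} → Matrix ℤ m n → Chain n → Set
InKernel A P = ∀ i → ∑ (λ j → A i j * sgnℤ (lookup P j)) ≡ + 0

InRowSpace : ∀ {m n} → Matrix ℤ m n → Chain n → Set
InRowSpace {m} A P =
  Σ (Fin m → ℚ) λ y → ∀ j → ∑ℚ (λ i → y i ℚ.* ℤtoℚ (A i j)) ≡ ℤtoℚ (sgnℤ (lookup P j))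

MatBasis : ∀ {m n} → Matrix ℤ m n → Subset n → Set
MatBasis {m} {n} A B =
  Σ (Fin m → Fin n) λ g → Injective _≡_ _≡_ g ×
    (∀ j → g j ∈ B) × (∀ x → x ∈ B → ∃ λ j → g j ≡ x) ×
    det (subMatrix A (λ i → i) g) ≢ + 0

M[_] : ∀ {m n} → Matrix ℤ m n → SignedMatroid n
M[_] {m} {n} A = record
  { IsBasis = MatBasis A
  ; SCirc   = λ P → InKernel A P × IsCircuit M₀ (supp P)
  ; SCocirc = λ P → InRowSpace A P × IsCocircuit M₀ (supp P)
  }
  where
  M₀ : SignedMatroid n
  M₀ = record { IsBasis = MatBasis A ; SCirc = λ _ → Lift⊤ ; SCocirc = λ _ → Lift⊤ }
    where
    open import Data.Unit using () renaming (⊤ to Lift⊤)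

-- Minors.  The ground set of M∖e and M/e is identified with Fin n via
-- the order-preserving embedding punchIn e : Fin n → Fin (suc n).

_∖ᶜ_ : ∀ {n} → Chain (suc n) → Fin (suc n) → Chain n
P ∖ᶜ e = removeAt P e

SuppMinimal : ∀ {n} → (Chain n → Set) → Chain n → Set
SuppMinimal R Q =
  R Q × Q ≢ zeroChain × (∀ Q′ → R Q′ → Q′ ≢ zeroChain → supp Q′ ⊆ supp Q → supp Q′ ≡ supp Q)

Restrictions : ∀ {n} → (Chain (suc n) → Set) → Fin (suc n) → Chain n → Set
Restrictions S e Q = Σ (Chain _) λ P → S P × P ∖ᶜ e ≡ Q

RestrictionsAvoiding : ∀ {n} → (Chain (suc n) → Set) → Fin (suc n) → Chain n → Set
RestrictionsAvoiding S e Q = Σ (Chain _) λ P → S P × lookup P e ≡ 𝟘 × P ∖ᶜ e ≡ Q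

_∖ₘ_ : ∀ {n} → SignedMatroid (suc n) → Fin (suc n) → SignedMatroid n
M ∖ₘ e = record
  { IsBasis = λ B → IsBasis (insertAt B e false)
  ; SCirc   = RestrictionsAvoiding SCirc e
  ; SCocirc = SuppMinimal (Restrictions SCocirc e)
  }
  where open SignedMatroid M

_/ₘ_ : ∀ {n} → SignedMatroid (suc n) → Fin (suc n) → SignedMatroid n
M /ₘ e = record
  { IsBasis = λ B → IsBasis (insertAt B e true)
  ; SCirc   = SuppMinimal (Restrictions SCirc e)
  ; SCocirc = RestrictionsAvoiding SCocirc e
  }
  where open SignedMatroid M

MinorSig : ∀ {n} → (Chain (suc n) → Set) → Fin (suc n) → (Chain n → Set) → Chain n → Set
MinorSig σ e S Q = Restrictions σ e Q × S Q

sig∖ : ∀ {n} → SignedMatroid (suc n) → (Chain (suc n) → Set) → Fin (suc n) → Chain n → Set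
sig∖ M σ e = MinorSig σ e (SignedMatroid.SCirc (M ∖ₘ e))

sig/ : ∀ {n} → SignedMatroid (suc n) → (Chain (suc n) → Set) → Fin (suc n) → Chain n → Set
sig/ M σ e = MinorSig σ e (SignedMatroid.SCirc (M /ₘ e))

cosig∖ : ∀ {n} → SignedMatroid (suc n) → (Chain (suc n) → Set) → Fin (suc n) → Chain n → Set
cosig∖ M σ* e = MinorSig σ* e (SignedMatroid.SCocirc (M ∖ₘ e))

cosig/ : ∀ {n} → SignedMatroid (suc n) → (Chain (suc n) → Set) → Fin (suc n) → Chain n → Set
cosig/ M σ* e = MinorSig σ* e (SignedMatroid.SCocirc (M /ₘ e))

-- Away from e the fourientations of the minor are restrictions
-- of those of M, and at e a lifted chain either vanishes or meets a fourientation that is {+,-} there, so a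
-- chain showing that the minor's signature is not triangulating lifts to one for M.  Every (co)circuit of the
-- minor is the restriction of a (co)circuit of M, unique since (co)circuits form antichains, whose signed
-- (co)circuit restricts to the required one.  The hypotheses on e enter through basis exchange: a non-coloop
-- can be exchanged out of, and a non-loop into, any basis.  For M(A) this is Cramer's rule applied to the
-- kernel chain of a fundamental circuit (supplied by σ); exchanging e out also uses the orthogonality of that
-- chain to the row-space chain of the fundamental cocircuit of e (supplied by σ*).

module Submission where

open import Defs
open import Algebra.Bundles using (CommutativeRing)
open import Data.Bool using (true; false; not)
import Data.Bool.Properties as Boolₚ
open import Data.Empty using (⊥-elim)
open import Data.Fin as Fin using (Fin; zero; suc; punchIn; punchOut; inject₁; toℕ)
import Data.Fin.Permutation.Components as PC
import Data.Fin.Properties as Finₚ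
open import Data.Fin.Subset using (Subset; _∈_; _∉_; _⊆_; _⊂_; _∪_; ⁅_⁆; ∁; _-_)
open import Data.Fin.Subset.Induction using (⊂-wellFounded; Acc; acc)
open import Data.Fin.Subset.Properties
  using (_∈?_; _⊆?_; _⊂?_; ⊆-antisym; ⊆-trans; anySubset?; x∈p∪q⁺; x∈p∪q⁻; x∈⁅x⁆; x∈⁅y⁆⇒x≡y;
         x∉p⇒x∈∁p; x∈∁p⇒x∉p; x∉∁p⇒x∈p; x∈p∧x≢y⇒x∈p-y; p─q⊆p)
open import Data.Integer as ℤ using (ℤ; +_; -_; _+_; _*_; +0; +[1+_]; -[1+_])
import Data.Integer.Properties as ℤₚ
open import Data.Integer.Tactic.RingSolver using (solve-∀)
open import Data.Nat as ℕ using (ℕ; zero; suc)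
import Data.Nat.Properties as ℕₚ
open import Data.Product using (Σ; ∃; _×_; _,_; proj₁; proj₂)
open import Data.Rational as ℚ using (ℚ; 0ℚ)
import Data.Rational.Properties as ℚₚ
open import Data.Rational.Solver using (module +-*-Solver)
import Data.Rational.Unnormalised as ℚᵘ
import Data.Rational.Unnormalised.Properties as ℚᵘₚ
open import Data.Sum using (_⊎_; inj₁; inj₂; [_,_]′)
open import Data.Vec using (Vec; _∷_; there; lookup; insertAt; removeAt)
import Data.Vec.Properties as Vecₚ
open import Data.Vec.Functional as Vector using (updateAt)
open import Data.Vec.Functional.Properties
  using (updateAt-updates; updateAt-minimal; updateAt-id-local; map-updateAt-local)
open import Function using (const; _∘_; _∘′_)
open import Function.Definitions using (Injective)
open import Relation.Binary.Definitions using (tri<; tri≈; tri>)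
open import Relation.Binary.PropositionalEquality
open import Relation.Nullary using (¬_; Dec; yes; no)
open import Relation.Nullary.Decidable using (_×-dec_; _→-dec_; ¬?; map′; decidable-stable)
open import Relation.Nullary.Negation using (contradiction)
open import Relation.Unary using (Decidable)

open import Algebra.Properties.AbelianGroup ℤₚ.+-0-abelianGroup using (inverseˡ-unique)
open import Algebra.Properties.Semiring.Sum ℤₚ.+-*-semiring
  using (sum; sum-cong-≗; ∑-distrib-+; *-distribˡ-sum; sum-remove; sum-replicate-zero)
import Algebra.Properties.Semiring.Sum (CommutativeRing.semiring ℚₚ.+-*-commutativeRing) as ℚΣ

open ≡-Reasoning

-- Sums and determinants over ℤ

∑≡sum : ∀ {n} (f : Fin n → ℤ) → ∑ f ≡ sum f
∑≡sum {zero}  f = refl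
∑≡sum {suc n} f = cong (_+_ (f zero)) (∑≡sum (λ i → f (suc i)))

sum-zero : ∀ {n} {f : Fin n → ℤ} → (∀ i → f i ≡ + 0) → sum f ≡ + 0
sum-zero {n} f≡0 = trans (sum-cong-≗ f≡0) (sum-replicate-zero n)

sum-single : ∀ {n} (f : Fin n → ℤ) {a} → (∀ c → c ≢ a → f c ≡ + 0) → sum f ≡ f a
sum-single {suc n} f {a} others = begin
  sum f                              ≡⟨ sum-remove f ⟩
  f a + sum (λ c → f (punchIn a c))  ≡⟨ cong (_+_ (f a)) (sum-zero (λ c → others _ (Finₚ.punchInᵢ≢i a c))) ⟩
  f a + + 0                          ≡⟨ ℤₚ.+-identityʳ (f a) ⟩
  f a                                ∎

sum-pair : ∀ {n} (f : Fin n → ℤ) {a b} → a ≢ b →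
           (∀ c → c ≢ a → c ≢ b → f c ≡ + 0) → sum f ≡ f a + f b
sum-pair {suc n} f {a} {b} a≢b others = begin
  sum f                              ≡⟨ sum-remove f ⟩
  f a + sum (λ c → f (punchIn a c))  ≡⟨ cong (_+_ (f a)) (sum-single _ rest) ⟩
  f a + f (punchIn a b′)             ≡⟨ cong (λ c → f a + f c) (Finₚ.punchIn-punchOut a≢b) ⟩
  f a + f b                          ∎
  where
  b′ = punchOut a≢b
  rest : ∀ c → c ≢ b′ → f (punchIn a c) ≡ + 0
  rest c c≢b′ = others _ (Finₚ.punchInᵢ≢i a c) λ eq →
    c≢b′ (Finₚ.punchIn-injective a c b′ (trans eq (sym (Finₚ.punchIn-punchOut a≢b))))

minor : ∀ {n} → Matrix ℤ (suc n) (suc n) → Fin (suc n) → Matrix ℤ n n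
minor M j i k = M (suc i) (punchIn j k)

expansionTerm : ∀ {n} → Matrix ℤ (suc n) (suc n) → Fin (suc n) → ℤ
expansionTerm M j = altSign (toℕ j) * (M zero j * det (minor M j))

det-expansion : ∀ {n} (M : Matrix ℤ (suc n) (suc n)) → det M ≡ sum (expansionTerm M)
det-expansion M = ∑≡sum (expansionTerm M)

det-cong : ∀ {n} {M N : Matrix ℤ n n} → (∀ i k → M i k ≡ N i k) → det M ≡ det N
det-cong {zero}  M≗N = refl
det-cong {suc n} {M} {N} M≗N = begin
  det M                  ≡⟨ det-expansion M ⟩
  sum (expansionTerm M)  ≡⟨ sum-cong-≗ (λ j → cong₂ (λ x d → altSign (toℕ j) * (x * d))
                                          (M≗N zero j) (det-cong (λ i k → M≗N (suc i) (punchIn j k)))) ⟩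
  sum (expansionTerm N)  ≡⟨ det-expansion N ⟨
  det N                  ∎

expansionTerm-linear-at : ∀ {n} (j : Fin (suc n)) (a b : ℤ) {M N P : Matrix ℤ (suc n) (suc n)} →
                          (∀ i k → k ≢ j → P i k ≡ M i k) → (∀ i k → k ≢ j → P i k ≡ N i k) →
                          P zero j ≡ a * M zero j + b * N zero j →
                          expansionTerm P j ≡ a * expansionTerm M j + b * expansionTerm N j
expansionTerm-linear-at j a b {M} {N} {P} P≗M P≗N P0j = begin
  s * (P zero j * det (minor P j))
    ≡⟨ cong₂ (λ x d → s * (x * d)) P0j (det-cong (λ i k → P≗M (suc i) _ (Finₚ.punchInᵢ≢i j k))) ⟩
  s * ((a * M zero j + b * N zero j) * det (minor M j))
    ≡⟨ ring s a b (M zero j) (N zero j) (det (minor M j)) ⟩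
  a * expansionTerm M j + b * (s * (N zero j * det (minor M j)))
    ≡⟨ cong (λ d → a * expansionTerm M j + b * (s * (N zero j * d))) (det-cong minorM≗minorN) ⟩
  a * expansionTerm M j + b * expansionTerm N j                 ∎
  where
  s = altSign (toℕ j)
  minorM≗minorN : ∀ i k → minor M j i k ≡ minor N j i k
  minorM≗minorN i k = trans (sym (P≗M (suc i) _ (Finₚ.punchInᵢ≢i j k))) (P≗N (suc i) _ (Finₚ.punchInᵢ≢i j k))
  ring : ∀ s a b x y d → s * ((a * x + b * y) * d) ≡ a * (s * (x * d)) + b * (s * (y * d))
  ring = solve-∀

det-linear : ∀ {n} (j : Fin n) (a b : ℤ) {M N P : Matrix ℤ n n} →
             (∀ i k → k ≢ j → P i k ≡ M i k) → (∀ i k → k ≢ j → P i k ≡ N i k) →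
             (∀ i → P i j ≡ a * M i j + b * N i j) → det P ≡ a * det M + b * det N
det-linear {suc n} j a b {M} {N} {P} P≗M P≗N Pj = begin
  det P                                                         ≡⟨ det-expansion P ⟩
  sum (expansionTerm P)                                         ≡⟨ sum-cong-≗ termwise ⟩
  sum (λ l → a * expansionTerm M l + b * expansionTerm N l)
    ≡⟨ ∑-distrib-+ (λ l → a * expansionTerm M l) (λ l → b * expansionTerm N l) ⟩
  sum (λ l → a * expansionTerm M l) + sum (λ l → b * expansionTerm N l)
    ≡⟨ sym (cong₂ _+_ (*-distribˡ-sum a (expansionTerm M)) (*-distribˡ-sum b (expansionTerm N))) ⟩
  a * sum (expansionTerm M) + b * sum (expansionTerm N)
    ≡⟨ sym (cong₂ (λ x y → a * x + b * y) (det-expansion M) (det-expansion N)) ⟩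
  a * det M + b * det N                                         ∎
  where
  termwise : ∀ l → expansionTerm P l ≡ a * expansionTerm M l + b * expansionTerm N l
  termwise l with l Fin.≟ j
  ... | yes refl = expansionTerm-linear-at l a b P≗M P≗N (Pj zero)
  ... | no l≢j = begin
    s * (P zero l * det (minor P l))
      ≡⟨ cong (λ d → s * (P zero l * d)) minor-linear ⟩
    s * (P zero l * (a * det (minor M l) + b * det (minor N l)))
      ≡⟨ ring s (P zero l) a b (det (minor M l)) (det (minor N l)) ⟩
    a * (s * (P zero l * det (minor M l))) + b * (s * (P zero l * det (minor N l)))
      ≡⟨ cong₂ (λ x y → a * (s * (x * det (minor M l))) + b * (s * (y * det (minor N l))))
               (P≗M zero l l≢j) (P≗N zero l l≢j) ⟩
    a * expansionTerm M l + b * expansionTerm N l                 ∎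
    where
    s = altSign (toℕ l)
    j′ = punchOut l≢j
    punchIn-j′ : punchIn l j′ ≡ j
    punchIn-j′ = Finₚ.punchIn-punchOut l≢j
    avoids-j : ∀ k → k ≢ j′ → punchIn l k ≢ j
    avoids-j k k≢j′ eq = k≢j′ (Finₚ.punchIn-injective l k j′ (trans eq (sym punchIn-j′)))
    minor-linear : det (minor P l) ≡ a * det (minor M l) + b * det (minor N l)
    minor-linear = det-linear j′ a b
      (λ i k k≢j′ → P≗M (suc i) _ (avoids-j k k≢j′))
      (λ i k k≢j′ → P≗N (suc i) _ (avoids-j k k≢j′))
      (λ i → subst (λ c → P (suc i) c ≡ a * M (suc i) c + b * N (suc i) c) (sym punchIn-j′) (Pj (suc i)))
    ring : ∀ s p a b X Y → s * (p * (a * X + b * Y)) ≡ a * (s * (p * X)) + b * (s * (p * Y))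
    ring = solve-∀

inject₁≢suc : ∀ {n} (j : Fin n) → inject₁ j ≢ suc j
inject₁≢suc zero    ()
inject₁≢suc (suc j) eq = inject₁≢suc j (Finₚ.suc-injective eq)

altSign-suc : ∀ k → altSign (suc k) ≡ - altSign k
altSign-suc zero          = refl
altSign-suc (suc zero)    = refl
altSign-suc (suc (suc k)) = altSign-suc k

punchIn-adjacent : ∀ {n} (j k : Fin n) →
                   punchIn (inject₁ j) k ≡ punchIn (suc j) k ⊎
                   (punchIn (inject₁ j) k ≡ suc j × punchIn (suc j) k ≡ inject₁ j)
punchIn-adjacent zero    zero    = inj₂ (refl , refl)
punchIn-adjacent zero    (suc k) = inj₁ refl
punchIn-adjacent (suc j) zero    = inj₁ refl
punchIn-adjacent (suc j) (suc k) with punchIn-adjacent j k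
... | inj₁ eq         = inj₁ (cong suc eq)
... | inj₂ (eq , eq′) = inj₂ (cong suc eq , cong suc eq′)

punchOut-adjacent : ∀ {n} (j : Fin (suc n)) (l : Fin (suc (suc n))) → l ≢ inject₁ j → l ≢ suc j →
                    ∃ λ j′ → punchIn l (inject₁ j′) ≡ inject₁ j × punchIn l (suc j′) ≡ suc j
punchOut-adjacent zero    zero             l≢j _    = contradiction refl l≢j
punchOut-adjacent zero    (suc zero)       _   l≢sj = contradiction refl l≢sj
punchOut-adjacent {suc n} zero    (suc (suc l)) _ _ = zero , refl , refl
punchOut-adjacent (suc j) zero             _   _    = j , refl , refl
punchOut-adjacent {suc n} (suc j) (suc l)  l≢j l≢sj with
  punchOut-adjacent j l (λ eq → l≢j (cong suc eq)) (λ eq → l≢sj (cong suc eq))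
... | j′ , eq , eq′ = suc j′ , cong suc eq , cong suc eq′

SwappedAdjacent : ∀ {m n} → Fin n → Matrix ℤ m (suc n) → Matrix ℤ m (suc n) → Set
SwappedAdjacent j M M′ = (∀ i → M′ i (inject₁ j) ≡ M i (suc j)) × (∀ i → M′ i (suc j) ≡ M i (inject₁ j)) ×
                         (∀ i k → k ≢ inject₁ j → k ≢ suc j → M′ i k ≡ M i k)

SwappedAdjacent-sym : ∀ {m n} {j : Fin n} {M M′ : Matrix ℤ m (suc n)} →
                      SwappedAdjacent j M M′ → SwappedAdjacent j M′ M
SwappedAdjacent-sym (left , right , others) =
  (λ i → sym (right i)) , (λ i → sym (left i)) , λ i k k≢ij k≢sj → sym (others i k k≢ij k≢sj)

minor-swapped : ∀ {n} {j : Fin n} {M M′ : Matrix ℤ (suc n) (suc n)} → SwappedAdjacent j M M′ →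
                ∀ i k → minor M′ (inject₁ j) i k ≡ minor M (suc j) i k
minor-swapped {j = j} {M} {M′} (_ , right , others) i k with punchIn-adjacent j k
... | inj₁ eq = trans (others (suc i) _ (Finₚ.punchInᵢ≢i (inject₁ j) k)
                                       (λ e → Finₚ.punchInᵢ≢i (suc j) k (trans (sym eq) e)))
                      (cong (M (suc i)) eq)
... | inj₂ (eq , eq′) = trans (cong (M′ (suc i)) eq) (trans (right (suc i)) (cong (M (suc i)) (sym eq′)))

expansionTerm-swapped : ∀ {n} {j : Fin n} {M M′ : Matrix ℤ (suc n) (suc n)} → SwappedAdjacent j M M′ →
                        expansionTerm M′ (inject₁ j) ≡ - expansionTerm M (suc j)
expansionTerm-swapped {j = j} {M} {M′} swapped@(left , _ , _) = begin
  altSign (toℕ (inject₁ j)) * (M′ zero (inject₁ j) * det (minor M′ (inject₁ j)))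
    ≡⟨ cong₂ _*_ (cong altSign (Finₚ.toℕ-inject₁ j)) (cong₂ _*_ (left zero) (det-cong (minor-swapped swapped))) ⟩
  altSign (toℕ j) * (M zero (suc j) * det (minor M (suc j)))
    ≡⟨ negate (altSign (toℕ j)) _ ⟩
  - ((- altSign (toℕ j)) * (M zero (suc j) * det (minor M (suc j))))
    ≡⟨ cong (λ s → - (s * (M zero (suc j) * det (minor M (suc j))))) (sym (altSign-suc (toℕ j))) ⟩
  - expansionTerm M (suc j)  ∎
  where
  negate : ∀ s x → s * x ≡ - ((- s) * x)
  negate = solve-∀

minor-swapped-outside : ∀ {n} {j : Fin (suc n)} {M M′ : Matrix ℤ (suc (suc n)) (suc (suc n))} →
                        SwappedAdjacent j M M′ →
                        ∀ l → l ≢ inject₁ j → l ≢ suc j → ∃ λ j′ → SwappedAdjacent j′ (minor M l) (minor M′ l)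
minor-swapped-outside {j = j} {M} {M′} (left , right , others) l l≢ij l≢sj with punchOut-adjacent j l l≢ij l≢sj
... | j′ , eq , eq′ = j′ ,
  (λ i → trans (cong (M′ (suc i)) eq) (trans (left (suc i)) (cong (M (suc i)) (sym eq′)))) ,
  (λ i → trans (cong (M′ (suc i)) eq′) (trans (right (suc i)) (cong (M (suc i)) (sym eq)))) ,
  (λ i k k≢ij′ k≢sj′ → others (suc i) _
     (λ e → k≢ij′ (Finₚ.punchIn-injective l k _ (trans e (sym eq))))
     (λ e → k≢sj′ (Finₚ.punchIn-injective l k _ (trans e (sym eq′)))))

det-swap-adjacent : ∀ {n} {j : Fin n} {M M′ : Matrix ℤ (suc n) (suc n)} → SwappedAdjacent j M M′ → det M′ ≡ - det M
det-swap-adjacent {suc n} {j} {M} {M′} swapped@(_ , _ , others) = inverseˡ-unique (det M′) (det M) (begin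
  det M′ + det M                                       ≡⟨ cong₂ _+_ (det-expansion M′) (det-expansion M) ⟩
  sum t′ + sum t                                       ≡⟨ ∑-distrib-+ t′ t ⟨
  sum (λ l → t′ l + t l)
    ≡⟨ sum-pair (λ l → t′ l + t l) (inject₁≢suc j) cancel-outside ⟩
  (t′ (inject₁ j) + t (inject₁ j)) + (t′ (suc j) + t (suc j))
    ≡⟨ cong₂ (λ x y → (x + t (inject₁ j)) + (y + t (suc j))) (expansionTerm-swapped swapped) term-suc ⟩
  (- t (suc j) + t (inject₁ j)) + (- t (inject₁ j) + t (suc j)) ≡⟨ ring (t (inject₁ j)) (t (suc j)) ⟩
  + 0                                                  ∎)
  where
  t = expansionTerm M
  t′ = expansionTerm M′
  ring : ∀ x y → (- y + x) + (- x + y) ≡ + 0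
  ring = solve-∀
  term-suc : t′ (suc j) ≡ - t (inject₁ j)
  term-suc = trans (sym (ℤₚ.neg-involutive (t′ (suc j))))
                   (cong -_ (sym (expansionTerm-swapped (SwappedAdjacent-sym swapped))))
  cancel-outside : ∀ l → l ≢ inject₁ j → l ≢ suc j → t′ l + t l ≡ + 0
  cancel-outside l l≢ij l≢sj = begin
    s * (M′ zero l * det (minor M′ l)) + s * (M zero l * det (minor M l))
      ≡⟨ cong₂ (λ x d → s * (x * d) + s * (M zero l * det (minor M l))) (others zero l l≢ij l≢sj)
               (det-swap-adjacent (proj₂ (minor-swapped-outside swapped l l≢ij l≢sj))) ⟩
    s * (M zero l * - det (minor M l)) + s * (M zero l * det (minor M l))
      ≡⟨ cancel s (M zero l) (det (minor M l)) ⟩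
    + 0 ∎
    where
    s = altSign (toℕ l)
    cancel : ∀ s x d → s * (x * - d) + s * (x * d) ≡ + 0
    cancel = solve-∀

self-negating : ∀ x → x ≡ - x → x ≡ + 0
self-negating +0       _  = refl
self-negating +[1+ n ] ()
self-negating -[1+ n ] ()

det-adjacent-columns : ∀ {n} (j : Fin n) (M : Matrix ℤ (suc n) (suc n)) →
                       (∀ i → M i (inject₁ j) ≡ M i (suc j)) → det M ≡ + 0
det-adjacent-columns j M eq =
  self-negating (det M) (det-swap-adjacent {j = j} {M} {M} (eq , (λ i → sym (eq i)) , λ _ _ _ _ → refl))

transpose-left : ∀ {n} (a b : Fin n) → PC.transpose a b a ≡ b
transpose-left a b with a Fin.≟ a
... | yes _   = refl
... | no a≢a = contradiction refl a≢a

transpose-right : ∀ {n} (a b : Fin n) → PC.transpose a b b ≡ a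
transpose-right a b with b Fin.≟ a
... | yes b≡a = b≡a
... | no _ with b Fin.≟ b
...   | yes _   = refl
...   | no b≢b = contradiction refl b≢b

transpose-other : ∀ {n} {a b c : Fin n} → c ≢ a → c ≢ b → PC.transpose a b c ≡ c
transpose-other {a = a} {b} {c} c≢a c≢b with c Fin.≟ a
... | yes c≡a = contradiction c≡a c≢a
... | no _ with c Fin.≟ b
...   | yes c≡b = contradiction c≡b c≢b
...   | no _    = refl

-- Swapping the adjacent columns inject₁ k and suc k moves the repeated column towards j; d bounds toℕ k.
det-ordered-equal-columns : ∀ d {n} (M : Matrix ℤ n n) {j k : Fin n} → toℕ j ℕ.< toℕ k → toℕ k ℕ.≤ d →
                            (∀ i → M i j ≡ M i k) → det M ≡ + 0
det-ordered-equal-columns (suc d) {suc n} M {j} {suc k} (ℕ.s≤s j≤k) (ℕ.s≤s k≤d) eq with j Fin.≟ inject₁ k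
... | yes refl = det-adjacent-columns k M eq
... | no j≢k = begin
  det M      ≡⟨ sym (ℤₚ.neg-involutive (det M)) ⟩
  - - det M  ≡⟨ cong -_ (sym swapped) ⟩
  - det M′   ≡⟨ cong -_ (det-ordered-equal-columns d M′ j<k k≤d′ equal′) ⟩
  + 0        ∎
  where
  M′ : Matrix ℤ (suc n) (suc n)
  M′ i c = M i (PC.transpose (inject₁ k) (suc k) c)
  swapped : det M′ ≡ - det M
  swapped = det-swap-adjacent {j = k} {M} {M′}
    ( (λ i → cong (M i) (transpose-left (inject₁ k) (suc k)))
    , (λ i → cong (M i) (transpose-right (inject₁ k) (suc k)))
    , (λ i c c≢k c≢sk → cong (M i) (transpose-other c≢k c≢sk)) )
  j≢sk : j ≢ suc k
  j≢sk refl = ℕₚ.1+n≰n j≤k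
  j<k : toℕ j ℕ.< toℕ (inject₁ k)
  j<k rewrite Finₚ.toℕ-inject₁ k =
    ℕₚ.≤∧≢⇒< j≤k (λ e → j≢k (Finₚ.toℕ-injective (trans e (sym (Finₚ.toℕ-inject₁ k)))))
  k≤d′ : toℕ (inject₁ k) ℕ.≤ d
  k≤d′ rewrite Finₚ.toℕ-inject₁ k = k≤d
  equal′ : ∀ i → M′ i j ≡ M′ i (inject₁ k)
  equal′ i = trans (cong (M i) (transpose-other j≢k j≢sk))
                   (trans (eq i) (sym (cong (M i) (transpose-left (inject₁ k) (suc k)))))

det-equal-columns : ∀ {n} (M : Matrix ℤ n n) {j k} → j ≢ k → (∀ i → M i j ≡ M i k) → det M ≡ + 0
det-equal-columns M {j} {k} j≢k eq with ℕₚ.<-cmp (toℕ j) (toℕ k)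
... | tri< j<k _ _ = det-ordered-equal-columns (toℕ k) M j<k ℕₚ.≤-refl eq
... | tri≈ _ j≡k _ = contradiction (Finₚ.toℕ-injective j≡k) j≢k
... | tri> _ _ k<j = det-ordered-equal-columns (toℕ j) M k<j ℕₚ.≤-refl (λ i → sym (eq i))

setColumn : ∀ {m n} → Matrix ℤ m n → Fin n → (Fin m → ℤ) → Matrix ℤ m n
setColumn M j v i = updateAt (M i) j (const (v i))

setColumn-≡ : ∀ {m n} (M : Matrix ℤ m n) j v i → setColumn M j v i j ≡ v i
setColumn-≡ M j v i = updateAt-updates j (M i)

setColumn-≢ : ∀ {m n} (M : Matrix ℤ m n) j v i {k} → k ≢ j → setColumn M j v i k ≡ M i k
setColumn-≢ M j v i {k} = updateAt-minimal k j (M i)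

det-setColumn-zero : ∀ {n} (G : Matrix ℤ n n) j → det (setColumn G j (λ _ → + 0)) ≡ + 0
det-setColumn-zero G j = trans
  (det-linear j (+ 0) (+ 0) {G} {G} (λ i k → setColumn-≢ G j zeros i) (λ i k → setColumn-≢ G j zeros i)
     (λ i → trans (setColumn-≡ G j zeros i) (zero-combination (G i j))))
  (sym (zero-combination (det G)))
  where
  zeros : Fin _ → ℤ
  zeros _ = + 0
  zero-combination : ∀ x → + 0 ≡ + 0 * x + + 0 * x
  zero-combination = solve-∀

det-setColumn-sum : ∀ {n N} (G : Matrix ℤ n n) j (s : Fin N → ℤ) (w : Fin N → Fin n → ℤ) →
                    det (setColumn G j (λ i → sum (λ c → s c * w c i))) ≡
                    sum (λ c → s c * det (setColumn G j (w c)))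
det-setColumn-sum {N = zero}  G j s w = det-setColumn-zero G j
det-setColumn-sum {N = suc N} G j s w = begin
  det (setColumn G j combination)
    ≡⟨ det-linear j (s zero) (+ 1) (same-off-j (w zero)) (same-off-j rest) (λ i →
         trans (setColumn-≡ G j combination i)
               (cong₂ (λ x y → s zero * x + y) (sym (setColumn-≡ G j (w zero) i))
                                               (sym (trans (ℤₚ.*-identityˡ _) (setColumn-≡ G j rest i))))) ⟩
  s zero * det (setColumn G j (w zero)) + + 1 * det (setColumn G j rest)
    ≡⟨ cong (_+_ (s zero * det (setColumn G j (w zero))))
            (trans (ℤₚ.*-identityˡ _) (det-setColumn-sum G j (λ c → s (suc c)) (λ c → w (suc c)))) ⟩
  sum (λ c → s c * det (setColumn G j (w c)))  ∎
  where
  rest : Fin _ → ℤ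
  rest i = sum (λ c → s (suc c) * w (suc c) i)
  combination : Fin _ → ℤ
  combination i = s zero * w zero i + rest i
  same-off-j : ∀ v i k → k ≢ j → setColumn G j combination i k ≡ setColumn G j v i k
  same-off-j v i k k≢j = trans (setColumn-≢ G j combination i k≢j) (sym (setColumn-≢ G j v i k≢j))

-- Orthogonality of the kernel and the row space

-- ℤtoℚ z is definitionally fromℚᵘ (mkℚᵘ z 0).
toℚᵘ-ℤtoℚ : ∀ z → ℚ.toℚᵘ (ℤtoℚ z) ℚᵘ.≃ ℚᵘ.mkℚᵘ z 0
toℚᵘ-ℤtoℚ z = ℚₚ.toℚᵘ-fromℚᵘ (ℚᵘ.mkℚᵘ z 0)

ℤtoℚ-homo-+ : ∀ a b → ℤtoℚ (a + b) ≡ ℤtoℚ a ℚ.+ ℤtoℚ b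
ℤtoℚ-homo-+ a b = ℚₚ.toℚᵘ-injective (ℚᵘₚ.≃-trans (toℚᵘ-ℤtoℚ (a + b)) (ℚᵘₚ.≃-trans (ℚᵘ.*≡* (ring a b))
  (ℚᵘₚ.≃-sym (ℚᵘₚ.≃-trans (ℚₚ.toℚᵘ-homo-+ (ℤtoℚ a) (ℤtoℚ b)) (ℚᵘₚ.+-cong (toℚᵘ-ℤtoℚ a) (toℚᵘ-ℤtoℚ b))))))
  where
  ring : ∀ a b → (a + b) * (+ 1 * + 1) ≡ (a * + 1 + b * + 1) * + 1
  ring = solve-∀

ℤtoℚ-homo-* : ∀ a b → ℤtoℚ (a * b) ≡ ℤtoℚ a ℚ.* ℤtoℚ b
ℤtoℚ-homo-* a b = ℚₚ.toℚᵘ-injective (ℚᵘₚ.≃-trans (toℚᵘ-ℤtoℚ (a * b)) (ℚᵘₚ.≃-trans (ℚᵘ.*≡* (ring a b))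
  (ℚᵘₚ.≃-sym (ℚᵘₚ.≃-trans (ℚₚ.toℚᵘ-homo-* (ℤtoℚ a) (ℤtoℚ b)) (ℚᵘₚ.*-cong (toℚᵘ-ℤtoℚ a) (toℚᵘ-ℤtoℚ b))))))
  where
  ring : ∀ a b → (a * b) * (+ 1 * + 1) ≡ (a * b) * + 1
  ring = solve-∀

ℤtoℚ≡0ℚ⇒≡0 : ∀ z → ℤtoℚ z ≡ 0ℚ → z ≡ + 0
ℤtoℚ≡0ℚ⇒≡0 z eq with ℚᵘₚ.≃-trans (ℚᵘₚ.≃-sym (toℚᵘ-ℤtoℚ z)) (ℚₚ.toℚᵘ-cong eq)
... | ℚᵘ.*≡* z*1≡0 = trans (sym (ℤₚ.*-identityʳ z)) z*1≡0

ℤtoℚ-sum : ∀ {n} (f : Fin n → ℤ) → ℤtoℚ (sum f) ≡ ℚΣ.sum (λ i → ℤtoℚ (f i))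
ℤtoℚ-sum {zero}  f = refl
ℤtoℚ-sum {suc n} f = trans (ℤtoℚ-homo-+ (f zero) (sum (λ i → f (suc i))))
                           (cong (ℤtoℚ (f zero) ℚ.+_) (ℤtoℚ-sum (λ i → f (suc i))))

∑ℚ≡sum : ∀ {n} (f : Fin n → ℚ) → ∑ℚ f ≡ ℚΣ.sum f
∑ℚ≡sum {zero}  f = refl
∑ℚ≡sum {suc n} f = cong (f zero ℚ.+_) (∑ℚ≡sum (λ i → f (suc i)))

kernel⊥rowSpace : ∀ {m n} (A : Matrix ℤ m n) {V Y : Chain n} → InKernel A V → InRowSpace A Y →
                  sum (λ j → sgnℤ (lookup V j) * sgnℤ (lookup Y j)) ≡ + 0
kernel⊥rowSpace {m} {n} A {V} {Y} AV≡0 (y , yA≡Y) = ℤtoℚ≡0ℚ⇒≡0 (sum (λ j → v j * w j)) (begin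
  ℤtoℚ (sum (λ j → v j * w j))                                  ≡⟨ ℤtoℚ-sum (λ j → v j * w j) ⟩
  ℚΣ.sum (λ j → ℤtoℚ (v j * w j))                               ≡⟨ ℚΣ.sum-cong-≗ expand-w ⟩
  ℚΣ.sum (λ j → ℚΣ.sum (λ i → ℤtoℚ (v j) ℚ.* (y i ℚ.* a i j)))
    ≡⟨ ℚΣ.∑-comm (λ j i → ℤtoℚ (v j) ℚ.* (y i ℚ.* a i j)) ⟩
  ℚΣ.sum (λ i → ℚΣ.sum (λ j → ℤtoℚ (v j) ℚ.* (y i ℚ.* a i j)))  ≡⟨ ℚΣ.sum-cong-≗ collect-Av ⟩
  ℚΣ.sum (λ i → y i ℚ.* 0ℚ)                                     ≡⟨ ℚΣ.sum-cong-≗ (λ i → ℚₚ.*-zeroʳ (y i)) ⟩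
  ℚΣ.sum {m} (λ _ → 0ℚ)                                         ≡⟨ ℚΣ.sum-replicate-zero m ⟩
  0ℚ                                                            ∎)
  where
  open +-*-Solver
  v w : Fin n → ℤ
  v j = sgnℤ (lookup V j)
  w j = sgnℤ (lookup Y j)
  a : Fin m → Fin n → ℚ
  a i j = ℤtoℚ (A i j)
  expand-w : ∀ j → ℤtoℚ (v j * w j) ≡ ℚΣ.sum (λ i → ℤtoℚ (v j) ℚ.* (y i ℚ.* a i j))
  expand-w j = begin
    ℤtoℚ (v j * w j)                                ≡⟨ ℤtoℚ-homo-* (v j) (w j) ⟩
    ℤtoℚ (v j) ℚ.* ℤtoℚ (w j)
      ≡⟨ cong (ℤtoℚ (v j) ℚ.*_) (trans (sym (yA≡Y j)) (∑ℚ≡sum (λ i → y i ℚ.* a i j))) ⟩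
    ℤtoℚ (v j) ℚ.* ℚΣ.sum (λ i → y i ℚ.* a i j)     ≡⟨ ℚΣ.*-distribˡ-sum (ℤtoℚ (v j)) (λ i → y i ℚ.* a i j) ⟩
    ℚΣ.sum (λ i → ℤtoℚ (v j) ℚ.* (y i ℚ.* a i j))   ∎
  collect-Av : ∀ i → ℚΣ.sum (λ j → ℤtoℚ (v j) ℚ.* (y i ℚ.* a i j)) ≡ y i ℚ.* 0ℚ
  collect-Av i = begin
    ℚΣ.sum (λ j → ℤtoℚ (v j) ℚ.* (y i ℚ.* a i j))    ≡⟨ ℚΣ.sum-cong-≗ (λ j → rearrange (ℤtoℚ (v j)) (y i) (a i j)) ⟩
    ℚΣ.sum (λ j → y i ℚ.* (a i j ℚ.* ℤtoℚ (v j)))    ≡⟨ ℚΣ.*-distribˡ-sum (y i) (λ j → a i j ℚ.* ℤtoℚ (v j)) ⟨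
    y i ℚ.* ℚΣ.sum (λ j → a i j ℚ.* ℤtoℚ (v j))      ≡⟨ cong (y i ℚ.*_) (sym Av-in-ℚ) ⟩
    y i ℚ.* 0ℚ                                      ∎
    where
    rearrange : ∀ x y a → x ℚ.* (y ℚ.* a) ≡ y ℚ.* (a ℚ.* x)
    rearrange = solve 3 (λ x y a → x :* (y :* a) := y :* (a :* x)) refl
    Av-in-ℚ : 0ℚ ≡ ℚΣ.sum (λ j → a i j ℚ.* ℤtoℚ (v j))
    Av-in-ℚ = begin
      0ℚ                                   ≡⟨ cong ℤtoℚ (trans (sym (AV≡0 i)) (∑≡sum (λ j → A i j * v j))) ⟩
      ℤtoℚ (sum (λ j → A i j * v j))       ≡⟨ ℤtoℚ-sum (λ j → A i j * v j) ⟩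
      ℚΣ.sum (λ j → ℤtoℚ (A i j * v j))    ≡⟨ ℚΣ.sum-cong-≗ (λ j → ℤtoℚ-homo-* (A i j) (v j)) ⟩
      ℚΣ.sum (λ j → a i j ℚ.* ℤtoℚ (v j))  ∎

-- Subsets and chains around a distinguished element

x∉p-x : ∀ {n} (p : Subset n) x → x ∉ p - x
x∉p-x (_ ∷ p) zero    ()
x∉p-x (_ ∷ p) (suc x) (there x∈p-x) = x∉p-x p x x∈p-x

x∈p-y⇒x≢y : ∀ {n} {p : Subset n} {x y} → x ∈ p - y → x ≢ y
x∈p-y⇒x≢y {p = p} {x} x∈p-x refl = x∉p-x p x x∈p-x

sgnℤ≡0⇒≡𝟘 : ∀ s → sgnℤ s ≡ + 0 → s ≡ 𝟘
sgnℤ≡0⇒≡𝟘 𝟘 _ = refl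

lookup⇒∈ : ∀ {n} {S : Subset n} {x} → lookup S x ≡ true → x ∈ S
lookup⇒∈ {S = S} {x} = Vecₚ.lookup⇒[]= x S

lookup⇒∉ : ∀ {n} {S : Subset n} {x} → lookup S x ≡ false → x ∉ S
lookup⇒∉ Sx≡false x∈S with trans (sym Sx≡false) (Vecₚ.[]=⇒lookup x∈S)
... | ()

x∈p∪⁅y⁆∧x≢y⇒x∈p : ∀ {n} {p : Subset n} {x y} → x ∈ p ∪ ⁅ y ⁆ → x ≢ y → x ∈ p
x∈p∪⁅y⁆∧x≢y⇒x∈p {p = p} {y = y} x∈p∪y x≢y with x∈p∪q⁻ p ⁅ y ⁆ x∈p∪y
... | inj₁ x∈p = x∈p
... | inj₂ x∈y = contradiction (x∈⁅y⁆⇒x≡y y x∈y) x≢y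

x∈∁p∪⁅y⁆∧x≢y⇒x∉p : ∀ {n} {p : Subset n} {x y} → x ∈ ∁ p ∪ ⁅ y ⁆ → x ≢ y → x ∉ p
x∈∁p∪⁅y⁆∧x≢y⇒x∉p x∈∁p∪y x≢y = x∈∁p⇒x∉p (x∈p∪⁅y⁆∧x≢y⇒x∈p x∈∁p∪y x≢y)

∉⇒lookup : ∀ {n} {S : Subset n} {x} → x ∉ S → lookup S x ≡ false
∉⇒lookup {S = S} {x} x∉S with lookup S x in Sx
... | true  = contradiction (lookup⇒∈ Sx) x∉S
... | false = refl

∈-supp⁺ : ∀ {n} (P : Chain n) {x} → lookup P x ≢ 𝟘 → x ∈ supp P
∈-supp⁺ P {x} Px≢0 = lookup⇒∈ (trans (Vecₚ.lookup∘tabulate _ x) (nonzero (lookup P x) Px≢0))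
  where
  nonzero : ∀ s → s ≢ 𝟘 → isNonzero s ≡ true
  nonzero ⊖ _   = refl
  nonzero 𝟘 0≢0 = contradiction refl 0≢0
  nonzero ⊕ _   = refl

∈-supp⁻ : ∀ {n} (P : Chain n) {x} → x ∈ supp P → lookup P x ≢ 𝟘
∈-supp⁻ P {x} x∈supp Px≡0
  with trans (sym (Vecₚ.[]=⇒lookup x∈supp)) (trans (Vecₚ.lookup∘tabulate _ x) (cong isNonzero Px≡0))
... | ()

∉-supp⁻ : ∀ {n} (P : Chain n) {x} → x ∉ supp P → lookup P x ≡ 𝟘
∉-supp⁻ P {x} x∉supp with lookup P x in Px
... | 𝟘 = refl
... | ⊖ = contradiction (∈-supp⁺ P λ Px≡0 → contradiction (trans (sym Px) Px≡0) λ ()) x∉supp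
... | ⊕ = contradiction (∈-supp⁺ P λ Px≡0 → contradiction (trans (sym Px) Px≡0) λ ()) x∉supp

supp⇒≢zeroChain : ∀ {n} (Q : Chain n) {x} → x ∈ supp Q → Q ≢ zeroChain
supp⇒≢zeroChain Q {x} x∈Q refl = ∈-supp⁻ Q x∈Q (Vecₚ.lookup-replicate x 𝟘)

data Split {n} (e : Fin (suc n)) : Fin (suc n) → Set where
  at-e : Split e e
  away : ∀ w → Split e (punchIn e w)

split : ∀ {n} (e y : Fin (suc n)) → Split e y
split e y with e Fin.≟ y
... | yes refl = at-e
... | no e≢y = subst (Split e) (Finₚ.punchIn-punchOut e≢y) (away (punchOut e≢y))

module _ {n} (e : Fin (suc n)) where

  lookup-removeAt : ∀ {A : Set} (xs : Vec A (suc n)) w → lookup (removeAt xs e) w ≡ lookup xs (punchIn e w)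
  lookup-removeAt xs w = trans (sym (Vecₚ.insertAt-punchIn (removeAt xs e) e (lookup xs e) w))
                               (cong (λ ys → lookup ys (punchIn e w)) (Vecₚ.insertAt-removeAt xs e))

  insertAt-removeAt-≡ : ∀ {A : Set} (xs : Vec A (suc n)) {v} → lookup xs e ≡ v → insertAt (removeAt xs e) e v ≡ xs
  insertAt-removeAt-≡ xs refl = Vecₚ.insertAt-removeAt xs e

  insertAt-≢ : ∀ {A : Set} {xs ys : Vec A n} v → xs ≢ ys → insertAt xs e v ≢ insertAt ys e v
  insertAt-≢ {xs = xs} {ys} v xs≢ys eq =
    xs≢ys (trans (sym (Vecₚ.removeAt-insertAt xs e v))
                 (trans (cong (λ zs → removeAt zs e) eq) (Vecₚ.removeAt-insertAt ys e v)))

  ∈-insertAt⁺ : ∀ {S : Subset n} {b w} → w ∈ S → punchIn e w ∈ insertAt S e b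
  ∈-insertAt⁺ {S} {b} {w} w∈S = lookup⇒∈ (trans (Vecₚ.insertAt-punchIn S e b w) (Vecₚ.[]=⇒lookup w∈S))

  ∈-insertAt⁻ : ∀ {S : Subset n} {b w} → punchIn e w ∈ insertAt S e b → w ∈ S
  ∈-insertAt⁻ {S} {b} {w} w∈S = lookup⇒∈ (trans (sym (Vecₚ.insertAt-punchIn S e b w)) (Vecₚ.[]=⇒lookup w∈S))

  e∈insertAt-true : ∀ {S : Subset n} → e ∈ insertAt S e true
  e∈insertAt-true {S} = lookup⇒∈ (Vecₚ.insertAt-lookup S e true)

  e∉insertAt-false : ∀ {S : Subset n} → e ∉ insertAt S e false
  e∉insertAt-false {S} = lookup⇒∉ (Vecₚ.insertAt-lookup S e false)

  ∈-removeAt⁺ : ∀ {S : Subset (suc n)} {w} → punchIn e w ∈ S → w ∈ removeAt S e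
  ∈-removeAt⁺ {S} {w} w∈S = lookup⇒∈ (trans (lookup-removeAt S w) (Vecₚ.[]=⇒lookup w∈S))

  ∈-removeAt⁻ : ∀ {S : Subset (suc n)} {w} → w ∈ removeAt S e → punchIn e w ∈ S
  ∈-removeAt⁻ {S} {w} w∈S = lookup⇒∈ (trans (sym (lookup-removeAt S w)) (Vecₚ.[]=⇒lookup w∈S))

  supp-removeAt : ∀ (P : Chain (suc n)) → supp (removeAt P e) ≡ removeAt (supp P) e
  supp-removeAt P =
    trans (sym (Vecₚ.tabulate∘lookup _)) (trans (Vecₚ.tabulate-cong pointwise) (Vecₚ.tabulate∘lookup _))
    where
    pointwise : ∀ w → lookup (supp (removeAt P e)) w ≡ lookup (removeAt (supp P) e) w
    pointwise w = begin
      lookup (supp (removeAt P e)) w       ≡⟨ Vecₚ.lookup∘tabulate _ w ⟩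
      isNonzero (lookup (removeAt P e) w)  ≡⟨ cong isNonzero (lookup-removeAt P w) ⟩
      isNonzero (lookup P (punchIn e w))   ≡⟨ Vecₚ.lookup∘tabulate (λ y → isNonzero (lookup P y)) (punchIn e w) ⟨
      lookup (supp P) (punchIn e w)        ≡⟨ lookup-removeAt (supp P) w ⟨
      lookup (removeAt (supp P) e) w       ∎

  ∈-supp-removeAt⁺ : ∀ (R : Chain (suc n)) {w} → punchIn e w ∈ supp R → w ∈ supp (removeAt R e)
  ∈-supp-removeAt⁺ R w∈R = subst (_ ∈_) (sym (supp-removeAt R)) (∈-removeAt⁺ w∈R)

  supp-insertAt-⊆ : ∀ (R : Chain (suc n)) {T : Subset n} {c x} → supp (removeAt R e) ⊆ T ∪ ⁅ x ⁆ →
                    (lookup R e ≢ 𝟘 → e ∈ insertAt T e c) → supp R ⊆ insertAt T e c ∪ ⁅ punchIn e x ⁆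
  supp-insertAt-⊆ R {T} {c} {x} R∖e⊆ e-ok {y} y∈R with split e y
  ... | at-e   = x∈p∪q⁺ (inj₁ (e-ok (∈-supp⁻ R y∈R)))
  ... | away w with x∈p∪q⁻ T ⁅ x ⁆ (R∖e⊆ (∈-supp-removeAt⁺ R y∈R))
  ...   | inj₁ w∈T = x∈p∪q⁺ (inj₁ (∈-insertAt⁺ w∈T))
  ...   | inj₂ w∈x rewrite x∈⁅y⁆⇒x≡y x w∈x = x∈p∪q⁺ (inj₂ (x∈⁅x⁆ (punchIn e x)))

  removeAt-⊆ : ∀ {D : Subset (suc n)} {C b} → D ⊆ insertAt C e b → removeAt D e ⊆ C
  removeAt-⊆ D⊆C w∈D = ∈-insertAt⁻ (D⊆C (∈-removeAt⁻ w∈D))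

  removeAt-≢ : ∀ {D : Subset (suc n)} {C b} → lookup D e ≡ b → D ≢ insertAt C e b → removeAt D e ≢ C
  removeAt-≢ {D} De≡b D≢C D∖e≡C = D≢C (trans (sym (insertAt-removeAt-≡ D De≡b)) (cong (λ S → insertAt S e _) D∖e≡C))

  ⊆-insertAt : ∀ {D : Subset (suc n)} {B b} → (e ∈ D → e ∈ insertAt B e b) → removeAt D e ⊆ B → D ⊆ insertAt B e b
  ⊆-insertAt e-case D∖e⊆B {y} y∈D with split e y
  ... | at-e   = e-case y∈D
  ... | away w = ∈-insertAt⁺ (D∖e⊆B (∈-removeAt⁺ y∈D))

  disjoint-insertAt : ∀ {D : Subset (suc n)} {B b} → (e ∈ D → e ∉ insertAt B e b) →
                      (∀ x → x ∈ removeAt D e → x ∉ B) → ∀ y → y ∈ D → y ∉ insertAt B e b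
  disjoint-insertAt e-case D∖e-disjoint y y∈D with split e y
  ... | at-e   = e-case y∈D
  ... | away w = λ w∈B → D∖e-disjoint w (∈-removeAt⁺ y∈D) (∈-insertAt⁻ w∈B)

  ⊆-from-removeAt : ∀ {S T : Subset (suc n)} → (e ∈ S → e ∈ T) → removeAt S e ≡ removeAt T e → S ⊆ T
  ⊆-from-removeAt e-case same {y} y∈S with split e y
  ... | at-e   = e-case y∈S
  ... | away w = ∈-removeAt⁻ (subst (_ ∈_) same (∈-removeAt⁺ y∈S))

  supp-removeAt-≡ : ∀ (R : Chain (suc n)) {C″ C} → supp R ≡ C″ → removeAt C″ e ≡ C → supp (removeAt R e) ≡ C
  supp-removeAt-≡ R suppR≡C″ C″∖e≡C = trans (supp-removeAt R) (trans (cong (λ S → removeAt S e) suppR≡C″) C″∖e≡C)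

  ⊆-or-⊇ : ∀ {X Y : Subset (suc n)} → removeAt X e ≡ removeAt Y e → X ⊆ Y ⊎ Y ⊆ X
  ⊆-or-⊇ {X} {Y} same with lookup X e in Xe
  ... | false = inj₁ (⊆-from-removeAt (λ e∈X → contradiction e∈X (lookup⇒∉ Xe)) same)
  ... | true  = inj₂ (⊆-from-removeAt (λ _ → lookup⇒∈ Xe) (sym same))

-- Matroids given by their bases

≟-subset : ∀ {n} (S T : Subset n) → Dec (S ≡ T)
≟-subset = Vecₚ.≡-dec Boolₚ._≟_

⊆∧≢⇒⊂ : ∀ {n} {D C : Subset n} → D ⊆ C → D ≢ C → D ⊂ C
⊆∧≢⇒⊂ {D = D} {C} D⊆C D≢C with Finₚ.any? (λ x → x ∈? C ×-dec ¬? (x ∈? D))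
... | yes witness = D⊆C , witness
... | no ¬witness = contradiction (⊆-antisym D⊆C C⊆D) D≢C
  where
  C⊆D : C ⊆ D
  C⊆D {x} x∈C with x ∈? D
  ... | yes x∈D = x∈D
  ... | no x∉D = contradiction (x , x∈C , x∉D) ¬witness

minimal-⊆ : ∀ {n} {P : Subset n → Set} → Decidable P → ∀ S → P S →
            ∃ λ C → C ⊆ S × P C × (∀ D → D ⊂ C → ¬ P D)
minimal-⊆ {P = P} P? S PS = descend S (⊂-wellFounded S) PS
  where
  descend : ∀ S → Acc _⊂_ S → P S → ∃ λ C → C ⊆ S × P C × (∀ D → D ⊂ C → ¬ P D)
  descend S (acc smaller) PS with anySubset? (λ D → D ⊂? S ×-dec P? D)
  ... | yes (D , D⊂S , PD) with descend D (smaller D⊂S) PD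
  ...   | C , C⊆D , PC , C-minimal = C , ⊆-trans C⊆D (proj₁ D⊂S) , PC , C-minimal
  descend S (acc smaller) PS | no ¬smaller = S , (λ x∈S → x∈S) , PS , λ D D⊂S PD → ¬smaller (D , D⊂S , PD)

module _ {n} (M : SignedMatroid n) where

  open SignedMatroid M

  Independent : Subset n → Set
  Independent S = Σ (Subset n) λ B → IsBasis B × S ⊆ B

  Avoided : Subset n → Set
  Avoided D = Σ (Subset n) λ B → IsBasis B × (∀ x → x ∈ D → x ∉ B)

  MeetsEveryBasis : Subset n → Set
  MeetsEveryBasis C = ∀ B → IsBasis B → ∃ λ x → x ∈ C × x ∈ B

  circuit-antichain : ∀ {C D} → IsCircuit M C → IsCircuit M D → C ⊆ D → C ≡ D
  circuit-antichain {C} {D} (C-dependent , _) (_ , D-minimal) C⊆D with ≟-subset C D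
  ... | yes C≡D = C≡D
  ... | no C≢D = contradiction (D-minimal C C⊆D C≢D) C-dependent

  cocircuit-antichain : ∀ {C D} → IsCocircuit M C → IsCocircuit M D → C ⊆ D → C ≡ D
  cocircuit-antichain {C} {D} (C-meets , _) (_ , D-minimal) C⊆D with ≟-subset C D
  ... | yes C≡D = C≡D
  ... | no C≢D with D-minimal C C⊆D C≢D
  ...   | B , B-basis , C-avoids-B with C-meets B B-basis
  ...     | x , x∈C , x∈B = contradiction x∈B (C-avoids-B x x∈C)

  DeletableFromBases : Fin n → Set
  DeletableFromBases e = ∀ {B} → IsBasis B → e ∈ B → ∃ λ B′ → IsBasis B′ × e ∉ B′ × (∀ {z} → z ∈ B → z ≢ e → z ∈ B′)

  InsertableIntoBases : Fin n → Set
  InsertableIntoBases e = ∀ {B} → IsBasis B → e ∉ B → ∃ λ B′ → IsBasis B′ × e ∈ B′ × B′ ⊆ B ∪ ⁅ e ⁆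

  circuit-⊆-∪-∋ : ∀ {Z B x} → IsCircuit M Z → IsBasis B → Z ⊆ B ∪ ⁅ x ⁆ → x ∈ Z
  circuit-⊆-∪-∋ {Z} {B} {x} (Z-dependent , _) B-basis Z⊆B∪x with x ∈? Z
  ... | yes x∈Z = x∈Z
  ... | no x∉Z = ⊥-elim (Z-dependent (B , B-basis , Z⊆B))
    where
    Z⊆B : Z ⊆ B
    Z⊆B y∈Z with x∈p∪q⁻ B ⁅ x ⁆ (Z⊆B∪x y∈Z)
    ... | inj₁ y∈B = y∈B
    ... | inj₂ y∈x = contradiction (subst (_∈ Z) (x∈⁅y⁆⇒x≡y x y∈x) y∈Z) x∉Z

  module _ (isBasis? : Decidable IsBasis) where

    independent? : Decidable Independent
    independent? S = anySubset? (λ B → isBasis? B ×-dec (S ⊆? B))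

    avoided? : Decidable Avoided
    avoided? D = anySubset? (λ B → isBasis? B ×-dec all-outside B)
      where
      all-outside : ∀ B → Dec (∀ x → x ∈ D → x ∉ B)
      all-outside B = Finₚ.all? (λ x → (x ∈? D) →-dec ¬? (x ∈? B))

    ¬avoided⇒meets : ∀ {C} → ¬ Avoided C → MeetsEveryBasis C
    ¬avoided⇒meets {C} ¬avoided B B-basis with Finₚ.any? (λ x → x ∈? C ×-dec x ∈? B)
    ... | yes common = common
    ... | no ¬common = contradiction (B , B-basis , λ x x∈C x∈B → ¬common (x , x∈C , x∈B)) ¬avoided

    ¬meets⇒avoided : ∀ {C} → ¬ MeetsEveryBasis C → Avoided C
    ¬meets⇒avoided {C} ¬meets with avoided? C
    ... | yes avoided = avoided
    ... | no ¬avoided = contradiction (¬avoided⇒meets ¬avoided) ¬meets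

    circuit-⊆-dependent : ∀ {S} → ¬ Independent S → ∃ λ C → IsCircuit M C × C ⊆ S
    circuit-⊆-dependent {S} S-dependent with minimal-⊆ (λ T → ¬? (independent? T)) S S-dependent
    ... | C , C⊆S , C-dependent , C-minimal = C , (C-dependent , proper-independent) , C⊆S
      where
      proper-independent : ∀ D → D ⊆ C → D ≢ C → Independent D
      proper-independent D D⊆C D≢C with independent? D
      ... | yes D-independent = D-independent
      ... | no D-dependent = contradiction D-dependent (C-minimal D (⊆∧≢⇒⊂ D⊆C D≢C))

    meetsEveryBasis? : Decidable MeetsEveryBasis
    meetsEveryBasis? C with avoided? C
    ... | yes (B , B-basis , C-avoids-B) =
          no λ C-meets → let x , x∈C , x∈B = C-meets B B-basis in C-avoids-B x x∈C x∈B
    ... | no ¬avoided = yes (¬avoided⇒meets ¬avoided)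

    cocircuit-⊆-meeting : ∀ {S} → MeetsEveryBasis S → ∃ λ K → IsCocircuit M K × K ⊆ S
    cocircuit-⊆-meeting {S} S-meets with minimal-⊆ meetsEveryBasis? S S-meets
    ... | K , K⊆S , K-meets , K-minimal =
          K , (K-meets , λ D D⊆K D≢K → ¬meets⇒avoided (K-minimal D (⊆∧≢⇒⊂ D⊆K D≢K))) , K⊆S

    ¬loop⇒basis∋ : ∀ {e} → ¬ IsLoop M e → ∃ λ B → IsBasis B × e ∈ B
    ¬loop⇒basis∋ {e} ¬loop with anySubset? (λ B → isBasis? B ×-dec e ∈? B)
    ... | yes found = found
    ... | no ¬found = contradiction (λ B B-basis e∈B → ¬found (B , B-basis , e∈B)) ¬loop

    ¬coloop⇒basis∌ : ∀ {e} → ¬ IsColoop M e → ∃ λ B → IsBasis B × e ∉ B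
    ¬coloop⇒basis∌ {e} ¬coloop with anySubset? (λ B → isBasis? B ×-dec ¬? (e ∈? B))
    ... | yes found = found
    ... | no ¬found =
          contradiction (λ B B-basis → decidable-stable (e ∈? B) λ e∉B → ¬found (B , B-basis , e∉B)) ¬coloop

    ¬loop⇒circuit-⊈⁅⁆ : ∀ {Z e} → ¬ IsLoop M e → IsCircuit M Z → ∃ λ f → f ∈ Z × f ≢ e
    ¬loop⇒circuit-⊈⁅⁆ {Z} {e} ¬loop (Z-dependent , _) with Finₚ.any? (λ f → f ∈? Z ×-dec ¬? (f Fin.≟ e))
    ... | yes other = other
    ... | no ¬other with ¬loop⇒basis∋ ¬loop
    ...   | B , B-basis , e∈B = ⊥-elim (Z-dependent (B , B-basis , Z⊆B))
      where
      Z⊆B : Z ⊆ B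
      Z⊆B {f} f∈Z with f Fin.≟ e
      ... | yes refl = e∈B
      ... | no f≢e = contradiction (f , f∈Z , f≢e) ¬other

    module _ (bases-maximal : ∀ {B B′} → IsBasis B → IsBasis B′ → B ⊆ B′ → B′ ⊆ B) where

      fundamental-circuit : ∀ {B x} → IsBasis B → x ∉ B → ∃ λ Z → IsCircuit M Z × Z ⊆ B ∪ ⁅ x ⁆
      fundamental-circuit {B} {x} B-basis x∉B = circuit-⊆-dependent λ (B′ , B′-basis , B∪x⊆B′) →
        x∉B (bases-maximal B-basis B′-basis (λ y∈B → B∪x⊆B′ (x∈p∪q⁺ (inj₁ y∈B))) (B∪x⊆B′ (x∈p∪q⁺ (inj₂ (x∈⁅x⁆ x)))))

      fundamental-cocircuit : ∀ {B x} → IsBasis B → x ∈ B → ∃ λ K → IsCocircuit M K × K ⊆ ∁ B ∪ ⁅ x ⁆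
      fundamental-cocircuit {B} {x} B-basis x∈B =
        cocircuit-⊆-meeting (¬avoided⇒meets λ (B′ , B′-basis , avoids-B′) →
          let B′⊆B : B′ ⊆ B
              B′⊆B {y} y∈B′ = x∉∁p⇒x∈p λ y∈∁B → avoids-B′ y (x∈p∪q⁺ (inj₁ y∈∁B)) y∈B′
          in avoids-B′ x (x∈p∪q⁺ (inj₂ (x∈⁅x⁆ x))) (bases-maximal B′-basis B-basis B′⊆B x∈B))

-- Triangulations of minors

-- IsTriangulating M σ is NoCompatible IsBasis SCirc (λ B → FB M B σ) by definition, and dually for σ*.
NoCompatible : ∀ {n} → (Subset n → Set) → (Chain n → Set) → (Subset n → Fourientation n) → Set
NoCompatible Basis S F =
  ∀ B₁ B₂ → Basis B₁ → Basis B₂ → B₁ ≢ B₂ → ∀ P → S P → ¬ Compatible P (F B₁ ∩F neg (F B₂))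

module _ {n} (e : Fin (suc n)) where

  lookup-restriction : ∀ (R : Chain (suc n)) {Q} → removeAt R e ≡ Q → ∀ w → lookup R (punchIn e w) ≡ lookup Q w
  lookup-restriction R R∖e≡Q w = trans (sym (lookup-removeAt e R w)) (cong (λ P → lookup P w) R∖e≡Q)

  NoCompatible-restrict :
    ∀ b {Basis S F} {Sₘ : Chain n → Set} {Fₘ : Subset n → Fourientation n} → NoCompatible Basis S F →
    (∀ {B x s} → Fₘ B x s → F (insertAt B e b) (punchIn e x) s) →
    (∀ {Q} → Sₘ Q → ∃ λ R → S R × removeAt R e ≡ Q × (lookup R e ≢ 𝟘 → ∀ {B} s → F (insertAt B e b) e s)) →
    NoCompatible (λ B → Basis (insertAt B e b)) Sₘ Fₘ
  NoCompatible-restrict b {F = F} none lift-F lift-chain B₁ B₂ B₁-basis B₂-basis B₁≢B₂ Q SₘQ Q-compatible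
    with lift-chain SₘQ
  ... | R , SR , R∖e≡Q , full-at-e =
    none _ _ B₁-basis B₂-basis (insertAt-≢ e b B₁≢B₂) R SR R-compatible
    where
    R-compatible : Compatible R (F (insertAt B₁ e b) ∩F neg (F (insertAt B₂ e b)))
    R-compatible y Ry≢0 with split e y
    ... | at-e   = full-at-e Ry≢0 _ , full-at-e Ry≢0 _
    ... | away w rewrite lookup-restriction R R∖e≡Q w =
          lift-F (proj₁ Q-compatible-w) , lift-F (proj₂ Q-compatible-w)
      where Q-compatible-w = Q-compatible w Ry≢0

  zero-at-e : ∀ (R₁ R₂ : Chain (suc n)) → removeAt R₂ e ≡ removeAt R₁ e → lookup R₂ e ≡ 𝟘 →
              (supp R₂ ⊆ supp R₁ → supp R₂ ≡ supp R₁) → lookup R₁ e ≡ 𝟘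
  zero-at-e R₁ R₂ same-restriction R₂e≡0 antichain =
    ∉-supp⁻ R₁ λ e∈R₁ → ∈-supp⁻ R₂ (subst (e ∈_) (sym (antichain R₂⊆R₁)) e∈R₁) R₂e≡0
    where
    R₂⊆R₁ : supp R₂ ⊆ supp R₁
    R₂⊆R₁ = ⊆-from-removeAt e (λ e∈R₂ → contradiction R₂e≡0 (∈-supp⁻ R₂ e∈R₂))
              (trans (sym (supp-removeAt e R₂)) (trans (cong supp same-restriction) (supp-removeAt e R₁)))

module _ {n} (M : SignedMatroid (suc n)) (e : Fin (suc n)) where

  ∁-insertAt : ∀ (B : Subset n) b → ∁ (insertAt B e b) ≡ insertAt (∁ B) e (not b)
  ∁-insertAt B b = Vecₚ.map-insertAt not b B e

  FB-restrict : ∀ {M′ : SignedMatroid n} {σ σ′ b B x s} → (∀ {P} → σ P → IsCircuit M (supp P)) →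
                (∀ {Q} → σ′ Q → ∃ λ R → σ R × removeAt R e ≡ Q × (lookup R e ≢ 𝟘 → e ∈ insertAt B e b)) →
                FB M′ B σ′ x s → FB M (insertAt B e b) σ (punchIn e x) s
  FB-restrict σ⇒circuit lift (inj₁ x∈B) = inj₁ (∈-insertAt⁺ e x∈B)
  FB-restrict σ⇒circuit lift (inj₂ (x∉B , D , _ , D⊆B∪x , Q , σ′Q , suppQ≡D , Qx≡s)) with lift σ′Q
  ... | R , σR , refl , e-ok =
    inj₂ ( x∉B ∘′ ∈-insertAt⁻ e , supp R , σ⇒circuit σR
         , supp-insertAt-⊆ e R (λ w∈Q → D⊆B∪x (subst (_ ∈_) suppQ≡D w∈Q)) e-ok
         , R , σR , refl , trans (sym (lookup-removeAt e R _)) Qx≡s )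

  FB*-restrict : ∀ {M′ : SignedMatroid n} {σ σ′ b B x s} → (∀ {P} → σ P → IsCocircuit M (supp P)) →
                 (∀ {Q} → σ′ Q → ∃ λ R → σ R × removeAt R e ≡ Q × (lookup R e ≢ 𝟘 → e ∉ insertAt B e b)) →
                 FB* M′ B σ′ x s → FB* M (insertAt B e b) σ (punchIn e x) s
  FB*-restrict σ⇒cocircuit lift (inj₁ x∉B) = inj₁ (x∉B ∘′ ∈-insertAt⁻ e)
  FB*-restrict {b = b} {B} σ⇒cocircuit lift (inj₂ (x∈B , D , _ , D⊆∁B∪x , Q , σ′Q , suppQ≡D , Qx≡s)) with lift σ′Q
  ... | R , σR , refl , e-ok =
    inj₂ ( ∈-insertAt⁺ e x∈B , supp R , σ⇒cocircuit σR
         , subst (λ T → supp R ⊆ T ∪ _) (sym (∁-insertAt B b))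
             (supp-insertAt-⊆ e R (λ w∈Q → D⊆∁B∪x (subst (_ ∈_) suppQ≡D w∈Q))
               (λ Re≢0 → subst (e ∈_) (∁-insertAt B b) (x∉p⇒x∈∁p (e-ok Re≢0))))
         , R , σR , refl , trans (sym (lookup-removeAt e R _)) Qx≡s )

module _ {n} (M : SignedMatroid (suc n)) (e : Fin (suc n))
         (SCirc⇒circuit : ∀ {P} → SignedMatroid.SCirc M P → IsCircuit M (supp P))
         (SCocirc⇒cocircuit : ∀ {P} → SignedMatroid.SCocirc M P → IsCocircuit M (supp P)) where

  open SignedMatroid M

  deletion-triangulating : ∀ {σ} → (∀ P → σ P → SCirc P) → IsTriangulating M σ →
                           IsTriangulating (M ∖ₘ e) (sig∖ M σ e)
  deletion-triangulating {σ} σ⊆SCirc triangulating =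
    NoCompatible-restrict e false {F = λ B → FB M B σ} triangulating (FB-restrict M e {M ∖ₘ e} σ⇒circuit lift)
      (λ (R , SR , Re≡0 , R∖e≡Q) → R , SR , R∖e≡Q , λ Re≢0 → contradiction Re≡0 Re≢0)
    where
    σ⇒circuit : ∀ {P} → σ P → IsCircuit M (supp P)
    σ⇒circuit σP = SCirc⇒circuit (σ⊆SCirc _ σP)
    lift : ∀ {B Q} → sig∖ M σ e Q → ∃ λ R → σ R × removeAt R e ≡ Q × (lookup R e ≢ 𝟘 → e ∈ insertAt B e false)
    lift ((R , σR , R∖e≡Q) , (R₂ , SR₂ , R₂e≡0 , R₂∖e≡Q)) =
      R , σR , R∖e≡Q , λ Re≢0 → contradiction Re≡0 Re≢0
      where
      Re≡0 = zero-at-e e R R₂ (trans R₂∖e≡Q (sym R∖e≡Q)) R₂e≡0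
               (circuit-antichain M (SCirc⇒circuit SR₂) (σ⇒circuit σR))

  contraction-triangulating : ∀ {σ} → (∀ P → σ P → SCirc P) → IsTriangulating M σ →
                              IsTriangulating (M /ₘ e) (sig/ M σ e)
  contraction-triangulating {σ} σ⊆SCirc triangulating =
    NoCompatible-restrict e true {F = λ B → FB M B σ} triangulating
      (FB-restrict M e {M /ₘ e} (λ σP → SCirc⇒circuit (σ⊆SCirc _ σP))
        (λ ((R , σR , R∖e≡Q) , _) → R , σR , R∖e≡Q , λ _ → e∈insertAt-true e))
      (λ ((R , SR , R∖e≡Q) , _) → R , SR , R∖e≡Q , λ _ _ → inj₁ (e∈insertAt-true e))

  deletion-triangulating* : ∀ {σ*} → (∀ P → σ* P → SCocirc P) → IsTriangulating* M σ* →
                            IsTriangulating* (M ∖ₘ e) (cosig∖ M σ* e)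
  deletion-triangulating* {σ*} σ*⊆SCocirc triangulating =
    NoCompatible-restrict e false {F = λ B → FB* M B σ*} triangulating
      (FB*-restrict M e {M ∖ₘ e} (λ σ*P → SCocirc⇒cocircuit (σ*⊆SCocirc _ σ*P))
        (λ ((R , σ*R , R∖e≡Q) , _) → R , σ*R , R∖e≡Q , λ _ → e∉insertAt-false e))
      (λ ((R , SR , R∖e≡Q) , _) → R , SR , R∖e≡Q , λ _ _ → inj₁ (e∉insertAt-false e))

  contraction-triangulating* : ∀ {σ*} → (∀ P → σ* P → SCocirc P) → IsTriangulating* M σ* →
                               IsTriangulating* (M /ₘ e) (cosig/ M σ* e)
  contraction-triangulating* {σ*} σ*⊆SCocirc triangulating =
    NoCompatible-restrict e true {F = λ B → FB* M B σ*} triangulating (FB*-restrict M e {M /ₘ e} σ*⇒cocircuit lift)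
      (λ (R , SR , Re≡0 , R∖e≡Q) → R , SR , R∖e≡Q , λ Re≢0 → contradiction Re≡0 Re≢0)
    where
    σ*⇒cocircuit : ∀ {P} → σ* P → IsCocircuit M (supp P)
    σ*⇒cocircuit σ*P = SCocirc⇒cocircuit (σ*⊆SCocirc _ σ*P)
    lift : ∀ {B Q} → cosig/ M σ* e Q → ∃ λ R → σ* R × removeAt R e ≡ Q × (lookup R e ≢ 𝟘 → e ∉ insertAt B e true)
    lift ((R , σ*R , R∖e≡Q) , (R₂ , SR₂ , R₂e≡0 , R₂∖e≡Q)) =
      R , σ*R , R∖e≡Q , λ Re≢0 → contradiction Re≡0 Re≢0
      where
      Re≡0 = zero-at-e e R R₂ (trans R₂∖e≡Q (sym R∖e≡Q)) R₂e≡0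
               (cocircuit-antichain M (SCocirc⇒cocircuit SR₂) (σ*⇒cocircuit σ*R))

-- Signatures of minors

-- The second component of IsCircuitSignature and IsCocircuitSignature.
UniquelySigned : ∀ {n} → (Subset n → Set) → (Chain n → Set) → Set
UniquelySigned Family σ =
  ∀ C → Family C → Σ (Chain _) λ P → σ P × supp P ≡ C × (∀ Q → σ Q → supp Q ≡ C → Q ≡ P)

module _ {n} (e : Fin (suc n)) where

  UniquelySigned-restrict :
    ∀ {Family : Subset (suc n) → Set} {σ} → (∀ {X Y} → Family X → Family Y → X ⊆ Y → X ≡ Y) →
    (∀ {P} → σ P → Family (supp P)) → UniquelySigned Family σ →
    ∀ {Familyₘ : Subset n → Set} {Sₘ : Chain n → Set} →
    (∀ {C} → Familyₘ C → ∃ λ C″ → Family C″ × removeAt C″ e ≡ C × (∀ {V} → σ V → supp V ≡ C″ → Sₘ (removeAt V e))) →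
    UniquelySigned Familyₘ (MinorSig σ e Sₘ)
  UniquelySigned-restrict {σ = σ} antichain σ⇒family signed {Sₘ = Sₘ} lift C C-in-minor
    with lift C-in-minor
  ... | C″ , C″-in-family , C″∖e≡C , restriction-in-Sₘ with signed C″ C″-in-family
  ...   | V , σV , suppV≡C″ , V-unique =
    removeAt V e , ((V , σV , refl) , restriction-in-Sₘ σV suppV≡C″) , supp-removeAt-≡ e V suppV≡C″ C″∖e≡C , unique
    where
    unique : ∀ Q → MinorSig σ e Sₘ Q → supp Q ≡ C → Q ≡ removeAt V e
    unique Q ((R , σR , refl) , _) suppQ≡C = cong (λ P → removeAt P e) (V-unique R σR suppR≡C″)
      where
      same-restriction : removeAt (supp R) e ≡ removeAt C″ e
      same-restriction = trans (sym (supp-removeAt e R)) (trans suppQ≡C (sym C″∖e≡C))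
      suppR≡C″ : supp R ≡ C″
      suppR≡C″ with ⊆-or-⊇ e same-restriction
      ... | inj₁ R⊆C″ = antichain (σ⇒family σR) C″-in-family R⊆C″
      ... | inj₂ C″⊆R = sym (antichain C″-in-family (σ⇒family σR) C″⊆R)

  RestrictionsAvoiding-restriction : ∀ {S : Chain (suc n) → Set} {V C} → S V → supp V ≡ insertAt C e false →
                                     RestrictionsAvoiding S e (removeAt V e)
  RestrictionsAvoiding-restriction {V = V} SV suppV≡C⁰ =
    V , SV , ∉-supp⁻ V (subst (e ∉_) (sym suppV≡C⁰) (e∉insertAt-false e)) , refl

  SuppMinimal-restriction : ∀ {S : Chain (suc n) → Set} {V C″ C} → S V → supp V ≡ C″ → removeAt C″ e ≡ C →
                            ∃ (_∈ C) → (∀ {Q} → Restrictions S e Q → supp Q ⊆ C → supp Q ≡ C) →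
                            SuppMinimal (Restrictions S e) (removeAt V e)
  SuppMinimal-restriction {V = V} SV suppV≡C″ C″∖e≡C (x , x∈C) minimal =
    (V , SV , refl) , supp⇒≢zeroChain (removeAt V e) (subst (x ∈_) (sym suppQ≡C) x∈C) ,
    λ Q Q-restriction _ Q⊆ → trans (minimal Q-restriction (subst (_ ⊆_) suppQ≡C Q⊆)) (sym suppQ≡C)
    where
    suppQ≡C = supp-removeAt-≡ e V suppV≡C″ C″∖e≡C

module _ {n} (M : SignedMatroid (suc n)) (e : Fin (suc n)) where

  open SignedMatroid M

  basis-removeAt : ∀ {B b} → IsBasis B → lookup B e ≡ b → IsBasis (insertAt (removeAt B e) e b)
  basis-removeAt {B} B-basis Be≡b = subst IsBasis (sym (insertAt-removeAt-≡ e B Be≡b)) B-basis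

  deletion-circuit-lift : ∀ {C} → DeletableFromBases M e → IsCircuit (M ∖ₘ e) C → IsCircuit M (insertAt C e false)
  deletion-circuit-lift {C} drop (C-dependent , C-minimal) = C⁰-dependent , C⁰-minimal
    where
    C⁰ = insertAt C e false
    e∉⊆C⁰ : ∀ {D} → D ⊆ C⁰ → e ∉ D
    e∉⊆C⁰ D⊆C⁰ e∈D = e∉insertAt-false e (D⊆C⁰ e∈D)
    not-in-basis-avoiding-e : ∀ {B} → IsBasis B → e ∉ B → ¬ C⁰ ⊆ B
    not-in-basis-avoiding-e {B} B-basis e∉B C⁰⊆B =
      C-dependent (removeAt B e , basis-removeAt B-basis (∉⇒lookup e∉B) ,
                   λ w∈C → ∈-removeAt⁺ e (C⁰⊆B (∈-insertAt⁺ e w∈C)))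
    C⁰-dependent : ¬ Independent M C⁰
    C⁰-dependent (B , B-basis , C⁰⊆B) with e ∈? B
    ... | no e∉B = not-in-basis-avoiding-e B-basis e∉B C⁰⊆B
    ... | yes e∈B with drop B-basis e∈B
    ...   | B′ , B′-basis , e∉B′ , B∖e⊆B′ =
      not-in-basis-avoiding-e B′-basis e∉B′ λ y∈C⁰ → B∖e⊆B′ (C⁰⊆B y∈C⁰) λ { refl → e∉⊆C⁰ (λ y∈C⁰ → y∈C⁰) y∈C⁰ }
    C⁰-minimal : ∀ D → D ⊆ C⁰ → D ≢ C⁰ → Independent M D
    C⁰-minimal D D⊆C⁰ D≢C⁰
      with C-minimal (removeAt D e) (removeAt-⊆ e D⊆C⁰) (removeAt-≢ e (∉⇒lookup (e∉⊆C⁰ D⊆C⁰)) D≢C⁰)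
    ... | B , B⁰-basis , D∖e⊆B =
      insertAt B e false , B⁰-basis , ⊆-insertAt e (λ e∈D → contradiction e∈D (e∉⊆C⁰ D⊆C⁰)) D∖e⊆B

  contraction-cocircuit-lift : ∀ {C} → InsertableIntoBases M e → IsCocircuit (M /ₘ e) C →
                               IsCocircuit M (insertAt C e false)
  contraction-cocircuit-lift {C} insert (C-meets , C-minimal) = C⁰-meets , C⁰-minimal
    where
    C⁰ = insertAt C e false
    e∉⊆C⁰ : ∀ {D} → D ⊆ C⁰ → e ∉ D
    e∉⊆C⁰ D⊆C⁰ e∈D = e∉insertAt-false e (D⊆C⁰ e∈D)
    meets-basis∋e : ∀ {B} → IsBasis B → e ∈ B → ∃ λ x → punchIn e x ∈ C⁰ × punchIn e x ∈ B
    meets-basis∋e B-basis e∈B with C-meets _ (basis-removeAt B-basis (Vecₚ.[]=⇒lookup e∈B))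
    ... | x , x∈C , x∈B∖e = x , ∈-insertAt⁺ e x∈C , ∈-removeAt⁻ e x∈B∖e
    C⁰-meets : MeetsEveryBasis M C⁰
    C⁰-meets B B-basis with e ∈? B
    ... | yes e∈B = let x , x∈C⁰ , x∈B = meets-basis∋e B-basis e∈B in punchIn e x , x∈C⁰ , x∈B
    ... | no e∉B with insert B-basis e∉B
    ...   | B′ , B′-basis , e∈B′ , B′⊆B∪e with meets-basis∋e B′-basis e∈B′
    ...     | x , x∈C⁰ , x∈B′ = punchIn e x , x∈C⁰ , x∈p∪⁅y⁆∧x≢y⇒x∈p (B′⊆B∪e x∈B′) (Finₚ.punchInᵢ≢i e x)
    C⁰-minimal : ∀ D → D ⊆ C⁰ → D ≢ C⁰ → Avoided M D
    C⁰-minimal D D⊆C⁰ D≢C⁰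
      with C-minimal (removeAt D e) (removeAt-⊆ e D⊆C⁰) (removeAt-≢ e (∉⇒lookup (e∉⊆C⁰ D⊆C⁰)) D≢C⁰)
    ... | B , B⁺-basis , D∖e-avoids-B =
      insertAt B e true , B⁺-basis , disjoint-insertAt e (λ e∈D → contradiction e∈D (e∉⊆C⁰ D⊆C⁰)) D∖e-avoids-B

  proper-lift-independent : ∀ {C} → (∀ D → D ⊆ C → D ≢ C → Independent (M /ₘ e) D) →
                            ∀ {b D} → D ⊆ insertAt C e b → D ≢ insertAt C e b → lookup D e ≡ b → Independent M D
  proper-lift-independent C-minimal {D = D} D⊆ D≢ De≡b
    with C-minimal (removeAt D e) (removeAt-⊆ e D⊆) (removeAt-≢ e De≡b D≢)
  ... | B , B⁺-basis , D∖e⊆B = insertAt B e true , B⁺-basis , ⊆-insertAt e (λ _ → e∈insertAt-true e) D∖e⊆B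

  proper-lift-avoided : ∀ {C} → (∀ D → D ⊆ C → D ≢ C → Avoided (M ∖ₘ e) D) →
                        ∀ {b D} → D ⊆ insertAt C e b → D ≢ insertAt C e b → lookup D e ≡ b → Avoided M D
  proper-lift-avoided C-minimal {D = D} D⊆ D≢ De≡b
    with C-minimal (removeAt D e) (removeAt-⊆ e D⊆) (removeAt-≢ e De≡b D≢)
  ... | B , B⁰-basis , D∖e-avoids-B =
    insertAt B e false , B⁰-basis , disjoint-insertAt e (λ _ → e∉insertAt-false e) D∖e-avoids-B

  contraction-circuit-nonempty : ∀ {C} → ¬ IsLoop M e → IsCircuit (M /ₘ e) C → ∃ (_∈ C)
  contraction-circuit-nonempty {C} ¬loop (C-dependent , _) with Finₚ.any? (_∈? C)
  ... | yes nonempty = nonempty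
  ... | no empty = contradiction (λ B B-basis e∈B → C-dependent
        (removeAt B e , basis-removeAt B-basis (Vecₚ.[]=⇒lookup e∈B) , λ {x} x∈C → contradiction (x , x∈C) empty))
        ¬loop

  contraction-circuit-minimal : ∀ {C Q} → (∀ {P} → SCirc P → IsCircuit M (supp P)) → IsCircuit (M /ₘ e) C →
                                Restrictions SCirc e Q → supp Q ⊆ C → supp Q ≡ C
  contraction-circuit-minimal {C} SCirc⇒circuit (_ , C-minimal) (R , SR , refl) Q⊆C
    with ≟-subset (supp (removeAt R e)) C
  ... | yes Q≡C = Q≡C
  ... | no Q≢C with C-minimal _ Q⊆C Q≢C
  ...   | B , B⁺-basis , Q⊆B = ⊥-elim (proj₁ (SCirc⇒circuit SR)
          (insertAt B e true , B⁺-basis , ⊆-insertAt e (λ _ → e∈insertAt-true e)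
                                            (λ w∈R → Q⊆B (subst (_ ∈_) (sym (supp-removeAt e R)) w∈R))))

  deletion-cocircuit-minimal : ∀ {C Q} → (∀ {P} → SCocirc P → IsCocircuit M (supp P)) → IsCocircuit (M ∖ₘ e) C →
                               Restrictions SCocirc e Q → supp Q ⊆ C → supp Q ≡ C
  deletion-cocircuit-minimal {C} SCocirc⇒cocircuit (_ , C-minimal) (R , SR , refl) Q⊆C
    with ≟-subset (supp (removeAt R e)) C
  ... | yes Q≡C = Q≡C
  ... | no Q≢C with C-minimal _ Q⊆C Q≢C
  ...   | B , B⁰-basis , Q-avoids-B with proj₁ (SCocirc⇒cocircuit SR) (insertAt B e false) B⁰-basis
  ...     | y , y∈R , y∈B⁰ = contradiction y∈B⁰ (disjoint-insertAt e {D = supp R} (λ _ → e∉insertAt-false e)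
              (λ w w∈R → Q-avoids-B w (subst (w ∈_) (sym (supp-removeAt e R)) w∈R)) y y∈R)

  module _ (isBasis? : Decidable IsBasis) where

    contraction-circuit-lift : ∀ {C} → IsCircuit (M /ₘ e) C → ∃ λ C″ → IsCircuit M C″ × removeAt C″ e ≡ C
    contraction-circuit-lift {C} (C-dependent , C-minimal) with independent? M isBasis? (insertAt C e false)
    ... | no C⁰-dependent =
      insertAt C e false ,
      (C⁰-dependent ,
       λ D D⊆ D≢ → proper-lift-independent C-minimal D⊆ D≢ (∉⇒lookup λ e∈D → e∉insertAt-false e (D⊆ e∈D))) ,
      Vecₚ.removeAt-insertAt C e false
    ... | yes (B₀ , B₀-basis , C⁰⊆B₀) =
      insertAt C e true , (C⁺-dependent , C⁺-minimal) , Vecₚ.removeAt-insertAt C e true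
      where
      C⁺-dependent : ¬ Independent M (insertAt C e true)
      C⁺-dependent (B , B-basis , C⁺⊆B) = C-dependent
        (removeAt B e , basis-removeAt B-basis (Vecₚ.[]=⇒lookup (C⁺⊆B (e∈insertAt-true e))) ,
         λ w∈C → ∈-removeAt⁺ e (C⁺⊆B (∈-insertAt⁺ e w∈C)))
      C⁺-minimal : ∀ D → D ⊆ insertAt C e true → D ≢ insertAt C e true → Independent M D
      C⁺-minimal D D⊆C⁺ D≢C⁺ with e ∈? D
      ... | yes e∈D = proper-lift-independent C-minimal D⊆C⁺ D≢C⁺ (Vecₚ.[]=⇒lookup e∈D)
      ... | no e∉D  =
        B₀ , B₀-basis , λ y∈D → C⁰⊆B₀ (⊆-insertAt e (λ e∈D → contradiction e∈D e∉D) (removeAt-⊆ e D⊆C⁺) y∈D)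

    deletion-cocircuit-lift : ∀ {C} → IsCocircuit (M ∖ₘ e) C → ∃ λ C″ → IsCocircuit M C″ × removeAt C″ e ≡ C
    deletion-cocircuit-lift {C} (C-meets , C-minimal) with avoided? M isBasis? (insertAt C e false)
    ... | no C⁰-meets =
      insertAt C e false ,
      (¬avoided⇒meets M isBasis? C⁰-meets ,
       λ D D⊆ D≢ → proper-lift-avoided C-minimal D⊆ D≢ (∉⇒lookup λ e∈D → e∉insertAt-false e (D⊆ e∈D))) ,
      Vecₚ.removeAt-insertAt C e false
    ... | yes (B₀ , B₀-basis , C⁰-avoids-B₀) =
      insertAt C e true , (C⁺-meets , C⁺-minimal) , Vecₚ.removeAt-insertAt C e true
      where
      C⁺-meets : MeetsEveryBasis M (insertAt C e true)
      C⁺-meets B B-basis with e ∈? B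
      ... | yes e∈B = e , e∈insertAt-true e , e∈B
      ... | no e∉B with C-meets (removeAt B e) (basis-removeAt B-basis (∉⇒lookup e∉B))
      ...   | x , x∈C , x∈B∖e = punchIn e x , ∈-insertAt⁺ e x∈C , ∈-removeAt⁻ e x∈B∖e
      C⁺-minimal : ∀ D → D ⊆ insertAt C e true → D ≢ insertAt C e true → Avoided M D
      C⁺-minimal D D⊆C⁺ D≢C⁺ with e ∈? D
      ... | yes e∈D = proper-lift-avoided C-minimal D⊆C⁺ D≢C⁺ (Vecₚ.[]=⇒lookup e∈D)
      ... | no e∉D  = B₀ , B₀-basis , λ y y∈D →
                      C⁰-avoids-B₀ y (⊆-insertAt e (λ e∈D → contradiction e∈D e∉D) (removeAt-⊆ e D⊆C⁺) y∈D)

    deletion-cocircuit-nonempty : ∀ {C} → ¬ IsColoop M e → IsCocircuit (M ∖ₘ e) C → ∃ (_∈ C)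
    deletion-cocircuit-nonempty ¬coloop (C-meets , _) with ¬coloop⇒basis∌ M isBasis? ¬coloop
    ... | B , B-basis , e∉B with C-meets (removeAt B e) (basis-removeAt B-basis (∉⇒lookup e∉B))
    ...   | x , x∈C , _ = x , x∈C

    module _ (SCirc⇒circuit : ∀ {P} → SCirc P → IsCircuit M (supp P))
             (SCocirc⇒cocircuit : ∀ {P} → SCocirc P → IsCocircuit M (supp P)) where

      deletion-circuit-signature : ∀ {σ} → DeletableFromBases M e → IsCircuitSignature M σ →
                                   IsCircuitSignature (M ∖ₘ e) (sig∖ M σ e)
      deletion-circuit-signature drop (σ⊆SCirc , signed) =
        (λ _ → proj₂) ,
        UniquelySigned-restrict e (circuit-antichain M) (λ σP → SCirc⇒circuit (σ⊆SCirc _ σP)) signed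
          λ {C} C-circuit →
          insertAt C e false , deletion-circuit-lift drop C-circuit , Vecₚ.removeAt-insertAt C e false ,
          λ σV → RestrictionsAvoiding-restriction e (σ⊆SCirc _ σV)

      contraction-circuit-signature : ∀ {σ} → ¬ IsLoop M e → IsCircuitSignature M σ →
                                      IsCircuitSignature (M /ₘ e) (sig/ M σ e)
      contraction-circuit-signature ¬loop (σ⊆SCirc , signed) =
        (λ _ → proj₂) ,
        UniquelySigned-restrict e (circuit-antichain M) (λ σP → SCirc⇒circuit (σ⊆SCirc _ σP)) signed λ C-circuit →
          let C″ , C″-circuit , C″∖e≡C = contraction-circuit-lift C-circuit in
          C″ , C″-circuit , C″∖e≡C ,
          λ σV suppV≡C″ → SuppMinimal-restriction e (σ⊆SCirc _ σV) suppV≡C″ C″∖e≡C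
                            (contraction-circuit-nonempty ¬loop C-circuit)
                            (contraction-circuit-minimal SCirc⇒circuit C-circuit)

      deletion-cocircuit-signature : ∀ {σ*} → ¬ IsColoop M e → IsCocircuitSignature M σ* →
                                     IsCocircuitSignature (M ∖ₘ e) (cosig∖ M σ* e)
      deletion-cocircuit-signature ¬coloop (σ*⊆SCocirc , signed) =
        (λ _ → proj₂) ,
        UniquelySigned-restrict e (cocircuit-antichain M) (λ σ*P → SCocirc⇒cocircuit (σ*⊆SCocirc _ σ*P)) signed
          λ C-cocircuit →
          let C″ , C″-cocircuit , C″∖e≡C = deletion-cocircuit-lift C-cocircuit in
          C″ , C″-cocircuit , C″∖e≡C ,
          λ σ*V suppV≡C″ → SuppMinimal-restriction e (σ*⊆SCocirc _ σ*V) suppV≡C″ C″∖e≡C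
                             (deletion-cocircuit-nonempty ¬coloop C-cocircuit)
                             (deletion-cocircuit-minimal SCocirc⇒cocircuit C-cocircuit)

      contraction-cocircuit-signature : ∀ {σ*} → InsertableIntoBases M e → IsCocircuitSignature M σ* →
                                        IsCocircuitSignature (M /ₘ e) (cosig/ M σ* e)
      contraction-cocircuit-signature insert (σ*⊆SCocirc , signed) =
        (λ _ → proj₂) ,
        UniquelySigned-restrict e (cocircuit-antichain M) (λ σ*P → SCocirc⇒cocircuit (σ*⊆SCocirc _ σ*P)) signed
          λ {C} C-cocircuit →
          insertAt C e false , contraction-cocircuit-lift insert C-cocircuit , Vecₚ.removeAt-insertAt C e false ,
          λ σ*V → RestrictionsAvoiding-restriction e (σ*⊆SCocirc _ σ*V)

-- The matroid of an integer matrix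

-- Functions are compared pointwise only, so P has to respect pointwise equality.
∃-function? : ∀ {m n} {P : (Fin m → Fin n) → Set} → (∀ {g h} → (∀ j → g j ≡ h j) → P g → P h) →
              Decidable P → Dec (∃ P)
∃-function? {zero} respects P? = map′ (λ P-empty → _ , P-empty) (λ (g , Pg) → respects (λ ()) Pg) (P? (λ ()))
∃-function? {suc m} {P = P} respects P? =
  map′ (λ (a , h , Ph) → _ , Ph)
       (λ (g , Pg) → g zero , (λ j → g (suc j)) , respects (λ { zero → refl ; (suc j) → refl }) Pg)
       (Finₚ.any? λ a →
          ∃-function? (λ g≗h → respects (λ { zero → refl ; (suc j) → g≗h j })) (λ h → P? (a Vector.∷ h)))

injective⇒surjective : ∀ {m} {π : Fin m → Fin m} → Injective _≡_ _≡_ π → ∀ k → ∃ λ j → π j ≡ k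
injective⇒surjective {m} {π} π-injective k with Finₚ.any? (λ j → π j Fin.≟ k)
... | yes hit = hit
injective⇒surjective {suc m} {π} π-injective k | no miss =
  contradiction (Finₚ.injective⇒≤ squeezed-injective) ℕₚ.1+n≰n
  where
  k≢π : ∀ j → k ≢ π j
  k≢π j k≡πj = miss (j , sym k≡πj)
  squeezed : Fin (suc m) → Fin m
  squeezed j = punchOut (k≢π j)
  squeezed-injective : Injective _≡_ _≡_ squeezed
  squeezed-injective {a} {b} eq = π-injective (Finₚ.punchOut-injective (k≢π a) (k≢π b) eq)

updateAt-enumeration : ∀ {m N} {B : Subset N} {g : Fin m → Fin N} {x} j₀ → Injective _≡_ _≡_ g → (∀ j → g j ∈ B) →
                       (∀ z → z ∈ B → ∃ λ j → g j ≡ z) → x ∉ B →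
                       let g′ = updateAt g j₀ (const x) in
                       Injective _≡_ _≡_ g′ × (∀ j → g′ j ∈ (B - g j₀) ∪ ⁅ x ⁆) ×
                       (∀ z → z ∈ (B - g j₀) ∪ ⁅ x ⁆ → ∃ λ j → g′ j ≡ z)
updateAt-enumeration {B = B} {g} {x} j₀ g-injective g∈B onto-B x∉B = g′-injective , g′∈B′ , onto-B′
  where
  g′ = updateAt g j₀ (const x)
  g≢x : ∀ j → g j ≢ x
  g≢x j gj≡x = x∉B (subst (_∈ B) gj≡x (g∈B j))
  g′-injective : Injective _≡_ _≡_ g′
  g′-injective {a} {b} eq with a Fin.≟ j₀ | b Fin.≟ j₀
  ... | yes refl | yes refl = refl
  ... | yes refl | no b≢j₀  =
    contradiction (trans (sym (updateAt-minimal b j₀ g b≢j₀)) (trans (sym eq) (updateAt-updates j₀ g))) (g≢x b)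
  ... | no a≢j₀  | yes refl =
    contradiction (trans (sym (updateAt-minimal a j₀ g a≢j₀)) (trans eq (updateAt-updates j₀ g))) (g≢x a)
  ... | no a≢j₀  | no b≢j₀  =
    g-injective (trans (sym (updateAt-minimal a j₀ g a≢j₀)) (trans eq (updateAt-minimal b j₀ g b≢j₀)))
  g′∈B′ : ∀ j → g′ j ∈ (B - g j₀) ∪ ⁅ x ⁆
  g′∈B′ j with j Fin.≟ j₀
  ... | yes refl = x∈p∪q⁺ (inj₂ (subst (_∈ ⁅ x ⁆) (sym (updateAt-updates j₀ g)) (x∈⁅x⁆ x)))
  ... | no j≢j₀ = x∈p∪q⁺ (inj₁ (subst (_∈ B - g j₀) (sym (updateAt-minimal j j₀ g j≢j₀))
                    (x∈p∧x≢y⇒x∈p-y (g∈B j) λ gj≡gj₀ → j≢j₀ (g-injective gj≡gj₀))))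
  onto-B′ : ∀ z → z ∈ (B - g j₀) ∪ ⁅ x ⁆ → ∃ λ j → g′ j ≡ z
  onto-B′ z z∈B′ with x∈p∪q⁻ (B - g j₀) ⁅ x ⁆ z∈B′
  ... | inj₂ z∈x = j₀ , trans (updateAt-updates j₀ g) (sym (x∈⁅y⁆⇒x≡y x z∈x))
  ... | inj₁ z∈B-gj₀ with onto-B z (p─q⊆p B ⁅ g j₀ ⁆ z∈B-gj₀)
  ...   | j , refl = j , updateAt-minimal j j₀ g λ { refl → x∈p-y⇒x≢y z∈B-gj₀ refl }

module _ {m N} (A : Matrix ℤ m N) where

  BasisEnumeration : Subset N → (Fin m → Fin N) → Set
  BasisEnumeration B g = Injective _≡_ _≡_ g × (∀ j → g j ∈ B) × (∀ x → x ∈ B → ∃ λ j → g j ≡ x) ×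
                         det (subMatrix A (λ i → i) g) ≢ + 0

  matBasis? : Decidable (MatBasis A)
  matBasis? B = ∃-function? respects λ g →
    injective? g ×-dec Finₚ.all? (λ j → g j ∈? B) ×-dec
    Finₚ.all? (λ x → (x ∈? B) →-dec Finₚ.any? (λ j → g j Fin.≟ x)) ×-dec
    ¬? (det (subMatrix A (λ i → i) g) ℤ.≟ + 0)
    where
    injective? : ∀ g → Dec (Injective _≡_ _≡_ g)
    injective? g with Finₚ.all? (λ a → Finₚ.all? (λ b → (g a Fin.≟ g b) →-dec (a Fin.≟ b)))
    ... | yes injective = yes λ {a} {b} → injective a b
    ... | no ¬injective = no λ injective → ¬injective (λ a b → injective)
    respects : ∀ {g h} → (∀ j → g j ≡ h j) → BasisEnumeration B g → BasisEnumeration B h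
    respects {g} {h} g≗h (g-injective , g∈B , onto-B , det≢0) =
      (λ {a} {b} ha≡hb → g-injective (trans (g≗h a) (trans ha≡hb (sym (g≗h b))))) ,
      (λ j → subst (_∈ B) (g≗h j) (g∈B j)) ,
      (λ x x∈B → let j , gj≡x = onto-B x x∈B in j , trans (sym (g≗h j)) gj≡x) ,
      (λ det≡0 → det≢0 (trans (det-cong (λ i k → cong (A i) (g≗h k))) det≡0))

  matBasis-maximal : ∀ {B B′} → MatBasis A B → MatBasis A B′ → B ⊆ B′ → B′ ⊆ B
  matBasis-maximal {B} {B′} (g , g-injective , g∈B , _) (g′ , _ , _ , onto-B′ , _) B⊆B′ {y} y∈B′ =
    subst (_∈ B) gj≡y (g∈B j)
    where
    position : Fin m → Fin m
    position j = proj₁ (onto-B′ (g j) (B⊆B′ (g∈B j)))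
    at-position : ∀ j → g′ (position j) ≡ g j
    at-position j = proj₂ (onto-B′ (g j) (B⊆B′ (g∈B j)))
    position-injective : Injective _≡_ _≡_ position
    position-injective {a} {b} eq = g-injective (trans (sym (at-position a)) (trans (cong g′ eq) (at-position b)))
    k = proj₁ (onto-B′ y y∈B′)
    j = proj₁ (injective⇒surjective position-injective k)
    gj≡y : g j ≡ y
    gj≡y = trans (sym (at-position j))
                 (trans (cong g′ (proj₂ (injective⇒surjective position-injective k))) (proj₂ (onto-B′ y y∈B′)))

  det-setColumn-kernel : ∀ {V} → InKernel A V → ∀ (G : Matrix ℤ m m) j →
                         sum (λ c → sgnℤ (lookup V c) * det (setColumn G j (λ i → A i c))) ≡ + 0
  det-setColumn-kernel {V} AV≡0 G j = begin
    sum (λ c → s c * det (setColumn G j (λ i → A i c)))   ≡⟨ det-setColumn-sum G j s (λ c i → A i c) ⟨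
    det (setColumn G j (λ i → sum (λ c → s c * A i c)))
      ≡⟨ det-cong (λ i k → cong (λ v → updateAt (G i) j (const v) k) (kernel i)) ⟩
    det (setColumn G j (λ _ → + 0))                       ≡⟨ det-setColumn-zero G j ⟩
    + 0                                                   ∎
    where
    s : Fin N → ℤ
    s c = sgnℤ (lookup V c)
    kernel : ∀ i → sum (λ c → s c * A i c) ≡ + 0
    kernel i = trans (sum-cong-≗ (λ c → ℤₚ.*-comm (s c) (A i c))) (trans (sym (∑≡sum (λ c → A i c * s c))) (AV≡0 i))

  -- Cramer's rule: in the vanishing sum of det-setColumn-kernel only the terms c = x and c = g j₀ survive,
  -- the others repeating a column of G.
  det-exchange≢0 : ∀ {g : Fin m → Fin N} {j₀ x V} → x ≢ g j₀ → (∀ {c} → c ∈ supp V → c ≢ x → ∃ λ j → g j ≡ c) →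
                   InKernel A V → lookup V (g j₀) ≢ 𝟘 → det (subMatrix A (λ i → i) g) ≢ + 0 →
                   det (subMatrix A (λ i → i) (updateAt g j₀ (const x))) ≢ + 0
  det-exchange≢0 {g} {j₀} {x} {V} x≢gj₀ suppV⊆g∪x AV≡0 Vgj₀≢0 det≢0 det′≡0 =
    [ Vgj₀≢0 ∘ sgnℤ≡0⇒≡𝟘 _ , det≢0 ]′ (ℤₚ.i*j≡0⇒i≡0∨j≡0 (s (g j₀)) gj₀-term≡0)
    where
    G : Matrix ℤ m m
    G = subMatrix A (λ i → i) g
    column : Fin N → Fin m → ℤ
    column c i = A i c
    s : Fin N → ℤ
    s c = sgnℤ (lookup V c)
    term : Fin N → ℤ
    term c = s c * det (setColumn G j₀ (column c))
    other-terms : ∀ c → c ≢ x → c ≢ g j₀ → term c ≡ + 0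
    other-terms c c≢x c≢gj₀ with c ∈? supp V
    ... | no c∉V = trans (cong (λ t → sgnℤ t * det (setColumn G j₀ (column c))) (∉-supp⁻ V c∉V))
                         (ℤₚ.*-zeroˡ (det (setColumn G j₀ (column c))))
    ... | yes c∈V with suppV⊆g∪x c∈V c≢x
    ...   | j , gj≡c = trans (cong (s c *_) repeated-column) (ℤₚ.*-zeroʳ (s c))
      where
      j₀≢j : j₀ ≢ j
      j₀≢j j₀≡j = c≢gj₀ (trans (sym gj≡c) (cong g (sym j₀≡j)))
      repeated-column : det (setColumn G j₀ (column c)) ≡ + 0
      repeated-column = det-equal-columns _ j₀≢j λ i →
        trans (setColumn-≡ G j₀ (column c) i)
              (sym (trans (setColumn-≢ G j₀ (column c) i (j₀≢j ∘ sym)) (cong (A i) gj≡c)))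
    gj₀-term≡0 : s (g j₀) * det G ≡ + 0
    gj₀-term≡0 = begin
      s (g j₀) * det G                          ≡⟨ ℤₚ.+-identityˡ _ ⟨
      + 0 + s (g j₀) * det G                    ≡⟨ cong (_+ s (g j₀) * det G) x-term≡0 ⟨
      term x + s (g j₀) * det G                 ≡⟨ cong (λ d → term x + s (g j₀) * d) replace-by-itself ⟨
      term x + term (g j₀)                      ≡⟨ sum-pair term x≢gj₀ other-terms ⟨
      sum term                                  ≡⟨ det-setColumn-kernel {V} AV≡0 G j₀ ⟩
      + 0                                       ∎
      where
      replace-by-itself : det (setColumn G j₀ (column (g j₀))) ≡ det G
      replace-by-itself = det-cong λ i → updateAt-id-local j₀ (G i) refl
      x-term≡0 : term x ≡ + 0
      x-term≡0 = begin
        s x * det (setColumn G j₀ (column x))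
          ≡⟨ cong (s x *_) (det-cong λ i k → sym (map-updateAt-local {f = A i} g j₀ refl k)) ⟩
        s x * det (subMatrix A (λ i → i) (updateAt g j₀ (const x))) ≡⟨ cong (s x *_) det′≡0 ⟩
        s x * + 0                                 ≡⟨ ℤₚ.*-zeroʳ (s x) ⟩
        + 0                                       ∎

  basis-exchange : ∀ {B x f V} → MatBasis A B → x ∉ B → f ∈ B → InKernel A V → supp V ⊆ B ∪ ⁅ x ⁆ →
                   lookup V f ≢ 𝟘 → MatBasis A ((B - f) ∪ ⁅ x ⁆)
  basis-exchange {B} {x} {f} {V} (g , g-injective , g∈B , onto-B , det≢0) x∉B f∈B AV≡0 suppV⊆B∪x Vf≢0
    with onto-B f f∈B
  ... | j₀ , refl =
    let g′-injective , g′∈B′ , onto-B′ = updateAt-enumeration j₀ g-injective g∈B onto-B x∉B in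
    updateAt g j₀ (const x) , g′-injective , g′∈B′ , onto-B′ ,
    det-exchange≢0 {V = V} (λ x≡gj₀ → x∉B (subst (_∈ B) (sym x≡gj₀) f∈B))
                   (λ c∈V c≢x → onto-B _ (x∈p∪⁅y⁆∧x≢y⇒x∈p (suppV⊆B∪x c∈V) c≢x)) AV≡0 Vf≢0 det≢0

  kernel⊥rowSpace-overlap : ∀ {V Y a b} → InKernel A V → InRowSpace A Y → a ≢ b →
                            (∀ c → c ≢ a → c ≢ b → lookup V c ≡ 𝟘 ⊎ lookup Y c ≡ 𝟘) →
                            lookup V b ≢ 𝟘 → lookup Y b ≢ 𝟘 → lookup V a ≢ 𝟘
  kernel⊥rowSpace-overlap {V} {Y} {a} {b} AV≡0 Y∈rowSpace a≢b disjoint-elsewhere Vb≢0 Yb≢0 Va≡0 =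
    [ Vb≢0 ∘ sgnℤ≡0⇒≡𝟘 _ , Yb≢0 ∘ sgnℤ≡0⇒≡𝟘 _ ]′ (ℤₚ.i*j≡0⇒i≡0∨j≡0 (sgnℤ (lookup V b)) b-term≡0)
    where
    product : Fin N → ℤ
    product c = sgnℤ (lookup V c) * sgnℤ (lookup Y c)
    vanishes : ∀ c → lookup V c ≡ 𝟘 ⊎ lookup Y c ≡ 𝟘 → product c ≡ + 0
    vanishes c (inj₁ Vc≡0) rewrite Vc≡0 = refl
    vanishes c (inj₂ Yc≡0) rewrite Yc≡0 = ℤₚ.*-zeroʳ (sgnℤ (lookup V c))
    b-term≡0 : product b ≡ + 0
    b-term≡0 = begin
      product b                ≡⟨ ℤₚ.+-identityˡ (product b) ⟨
      + 0 + product b          ≡⟨ cong (_+ product b) (vanishes a (inj₁ Va≡0)) ⟨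
      product a + product b    ≡⟨ sum-pair product a≢b (λ c c≢a c≢b → vanishes c (disjoint-elsewhere c c≢a c≢b)) ⟨
      sum product              ≡⟨ kernel⊥rowSpace A {V} {Y} AV≡0 Y∈rowSpace ⟩
      + 0                      ∎

  circuit⇒kernel-chain : ∀ {σ Z} → IsCircuitSignature M[ A ] σ → IsCircuit M[ A ] Z →
                         ∃ λ V → InKernel A V × supp V ≡ Z
  circuit⇒kernel-chain (σ⊆SCirc , signed) Z-circuit with signed _ Z-circuit
  ... | V , σV , suppV≡Z , _ = V , proj₁ (σ⊆SCirc V σV) , suppV≡Z

  cocircuit⇒rowSpace-chain : ∀ {σ* K} → IsCocircuitSignature M[ A ] σ* → IsCocircuit M[ A ] K →
                             ∃ λ Y → InRowSpace A Y × supp Y ≡ K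
  cocircuit⇒rowSpace-chain (σ*⊆SCocirc , signed) K-cocircuit with signed _ K-cocircuit
  ... | Y , σ*Y , suppY≡K , _ = Y , proj₁ (σ*⊆SCocirc Y σ*Y) , suppY≡K

  ¬loop⇒insertable : ∀ {σ e} → IsCircuitSignature M[ A ] σ → ¬ IsLoop M[ A ] e → InsertableIntoBases M[ A ] e
  ¬loop⇒insertable {e = e} signature ¬loop {B} B-basis e∉B
    with fundamental-circuit M[ A ] matBasis? matBasis-maximal B-basis e∉B
  ... | Z , Z-circuit , Z⊆B∪e with circuit⇒kernel-chain signature Z-circuit
                                 | ¬loop⇒circuit-⊈⁅⁆ M[ A ] matBasis? ¬loop Z-circuit
  ...   | V , AV≡0 , refl | f , f∈Z , f≢e =
    (B - f) ∪ ⁅ e ⁆ ,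
    basis-exchange {V = V} B-basis e∉B f∈B AV≡0 Z⊆B∪e (∈-supp⁻ V f∈Z) ,
    x∈p∪q⁺ (inj₂ (x∈⁅x⁆ e)) , B′⊆B∪e
    where
    f∈B : f ∈ B
    f∈B = x∈p∪⁅y⁆∧x≢y⇒x∈p (Z⊆B∪e f∈Z) f≢e
    B′⊆B∪e : (B - f) ∪ ⁅ e ⁆ ⊆ B ∪ ⁅ e ⁆
    B′⊆B∪e z∈B′ with x∈p∪q⁻ (B - f) ⁅ e ⁆ z∈B′
    ... | inj₁ z∈B-f = x∈p∪q⁺ (inj₁ (p─q⊆p B ⁅ f ⁆ z∈B-f))
    ... | inj₂ z∈e   = x∈p∪q⁺ (inj₂ z∈e)

  -- The fundamental circuit of f and the fundamental cocircuit of e meet only in {e, f}, so orthogonality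
  -- of their signed chains forces V e ≢ 𝟘.
  exchange-through-cocircuit : ∀ {σ σ* B K e f} → IsCircuitSignature M[ A ] σ → IsCocircuitSignature M[ A ] σ* →
                               MatBasis A B → e ∈ B → IsCocircuit M[ A ] K → K ⊆ ∁ B ∪ ⁅ e ⁆ → f ∈ K → f ≢ e →
                               MatBasis A ((B - e) ∪ ⁅ f ⁆)
  exchange-through-cocircuit {B = B} {K} {e} {f} signature signature* B-basis e∈B K-cocircuit K⊆∁B∪e f∈K f≢e
    with fundamental-circuit M[ A ] matBasis? matBasis-maximal B-basis (x∈∁p∪⁅y⁆∧x≢y⇒x∉p (K⊆∁B∪e f∈K) f≢e)
  ... | Z , Z-circuit , Z⊆B∪f
    with circuit⇒kernel-chain signature Z-circuit | cocircuit⇒rowSpace-chain signature* K-cocircuit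
  ...   | V , AV≡0 , refl | Y , Y∈rowSpace , refl =
    basis-exchange {V = V} B-basis (x∈∁p∪⁅y⁆∧x≢y⇒x∉p (K⊆∁B∪e f∈K) f≢e) e∈B AV≡0 Z⊆B∪f Ve≢0
    where
    Vf≢0 : lookup V f ≢ 𝟘
    Vf≢0 = ∈-supp⁻ V (circuit-⊆-∪-∋ M[ A ] Z-circuit B-basis Z⊆B∪f)
    supports-meet-at-e-f : ∀ c → c ≢ e → c ≢ f → lookup V c ≡ 𝟘 ⊎ lookup Y c ≡ 𝟘
    supports-meet-at-e-f c c≢e c≢f with c ∈? supp V | c ∈? supp Y
    ... | no c∉V  | _        = inj₁ (∉-supp⁻ V c∉V)
    ... | yes _   | no c∉Y   = inj₂ (∉-supp⁻ Y c∉Y)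
    ... | yes c∈V | yes c∈Y  =
      contradiction (x∈p∪⁅y⁆∧x≢y⇒x∈p (Z⊆B∪f c∈V) c≢f) (x∈∁p∪⁅y⁆∧x≢y⇒x∉p (K⊆∁B∪e c∈Y) c≢e)
    Ve≢0 : lookup V e ≢ 𝟘
    Ve≢0 = kernel⊥rowSpace-overlap {V} {Y} AV≡0 Y∈rowSpace (λ e≡f → f≢e (sym e≡f)) supports-meet-at-e-f
                                   Vf≢0 (∈-supp⁻ Y f∈K)

  ¬coloop⇒deletable : ∀ {σ σ* e} → IsCircuitSignature M[ A ] σ → IsCocircuitSignature M[ A ] σ* →
                      ¬ IsColoop M[ A ] e → DeletableFromBases M[ A ] e
  ¬coloop⇒deletable {e = e} signature signature* ¬coloop {B} B-basis e∈B
    with ¬coloop⇒basis∌ M[ A ] matBasis? ¬coloop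
       | fundamental-cocircuit M[ A ] matBasis? matBasis-maximal B-basis e∈B
  ... | B₀ , B₀-basis , e∉B₀ | K , K-cocircuit , K⊆∁B∪e with proj₁ K-cocircuit B₀ B₀-basis
  ...   | f , f∈K , f∈B₀ =
    (B - e) ∪ ⁅ f ⁆ , exchange-through-cocircuit signature signature* B-basis e∈B K-cocircuit K⊆∁B∪e f∈K f≢e ,
    e∉B′ , λ z∈B z≢e → x∈p∪q⁺ (inj₁ (x∈p∧x≢y⇒x∈p-y z∈B z≢e))
    where
    f≢e : f ≢ e
    f≢e refl = e∉B₀ f∈B₀
    e∉B′ : e ∉ (B - e) ∪ ⁅ f ⁆
    e∉B′ e∈B′ = x∉p-x B e (x∈p∪⁅y⁆∧x≢y⇒x∈p e∈B′ (λ e≡f → f≢e (sym e≡f)))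

lemma2p45 : ∀ {m n} (A : Matrix ℤ m (suc n)) →
    TotallyUnimodular A → FullRowRank A →
    (σ σ* : Chain (suc n) → Set) →
    IsCircuitSignature M[ A ] σ → IsTriangulating M[ A ] σ →
    IsCocircuitSignature M[ A ] σ* → IsTriangulating* M[ A ] σ* →
    (e : Fin (suc n)) →
    (¬ IsColoop M[ A ] e →
      (IsCircuitSignature (M[ A ] ∖ₘ e) (sig∖ M[ A ] σ e) ×
       IsTriangulating (M[ A ] ∖ₘ e) (sig∖ M[ A ] σ e)) ×
      (IsCocircuitSignature (M[ A ] ∖ₘ e) (cosig∖ M[ A ] σ* e) ×
       IsTriangulating* (M[ A ] ∖ₘ e) (cosig∖ M[ A ] σ* e))) ×
    (¬ IsLoop M[ A ] e →
      (IsCircuitSignature (M[ A ] /ₘ e) (sig/ M[ A ] σ e) ×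
       IsTriangulating (M[ A ] /ₘ e) (sig/ M[ A ] σ e)) ×
      (IsCocircuitSignature (M[ A ] /ₘ e) (cosig/ M[ A ] σ* e) ×
       IsTriangulating* (M[ A ] /ₘ e) (cosig/ M[ A ] σ* e)))
lemma2p45 A _ _ σ σ* signature triangulating signature* triangulating* e =
  (λ ¬coloop →
    ( deletion-circuit-signature M e isBasis? proj₂ proj₂ (¬coloop⇒deletable A signature signature* ¬coloop) signature
    , deletion-triangulating M e proj₂ proj₂ (proj₁ signature) triangulating ) ,
    ( deletion-cocircuit-signature M e isBasis? proj₂ proj₂ ¬coloop signature*
    , deletion-triangulating* M e proj₂ proj₂ (proj₁ signature*) triangulating* )) ,
  (λ ¬loop →
    ( contraction-circuit-signature M e isBasis? proj₂ proj₂ ¬loop signature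
    , contraction-triangulating M e proj₂ proj₂ (proj₁ signature) triangulating ) ,
    ( contraction-cocircuit-signature M e isBasis? proj₂ proj₂ (¬loop⇒insertable A signature ¬loop) signature*
    , contraction-triangulating* M e proj₂ proj₂ (proj₁ signature*) triangulating* ))
  where
  M = M[ A ]
  isBasis? = matBasis? A
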